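{- Let $\pi_1,\ldots,\pi_n$ be Lyndon permutations such that $\pi_1>_L\pi_2>_L\cdots>_L\pi_n$, and let $N$ be the size of the permutation $\pi_1\oplus\cdots\oplus\pi_n$. If $J_1,\ldots,J_n$ are pairwise disjoint subsets of $[N]$ such that, for every $i\in[n]$, the pattern induced by $J_i$ in $\pi_1\oplus\cdots\oplus\pi_n$ is $\pi_i$, then every $J_i$ is an interval and \[J_i=\{\,j+|\pi_1|+\cdots+|\pi_{i-1}| : j\in[|\pi_i|]\,\}\quad\text{for every } i\in[n].\]
   Context: A permutation of size $n$ is a bijection $\pi:[n]\to[n]$; $|\pi|$ denotes its size. The direct sum $\pi_1\oplus\pi_2$ of permutations of sizes $a,b$ is the permutation $\pi$ of size $a+b$ with $\pi(i)=\pi_1(i)$ for $i\in[a]$ and $\pi(a+i)=a+\pi_2(i)$ for $i\in[b]$. A permutation is indecomposable if it is not the direct sum of two permutations (of positive sizes). Every permutation $\pi$ is uniquely a direct sum $\tau_1\oplus\cdots\oplus\tau_m$ of indecomposable permutations, its indecomposable blocks; write $\overline{\pi}$ for the word $\tau_1\dots\tau_m$ over the alphabet $\Sigma$ of indecomposable permutations. $\Sigma$ is linearly ordered so that indecomposable permutations of smaller size precede those of larger size, and those of equal size are ordered lexicographically as words. Words over $\Sigma$ are compared lexicographically (a proper prefix is smaller). A word is a Lyndon word if every proper suffix is lexicographically strictly larger than the word itself; a permutation $\pi$ is a Lyndon permutation if $\overline{\pi}$ is a Lyndon word. $\pi>_L\pi'$ means $\overline{\pi}$ is lexicographically strictly larger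 than $\overline{\pi'}$. An interval is a set of consecutive integers. For $1\le k_1<\dots<k_m\le n$, the pattern induced by $\{k_1,\dots,k_m\}$ in a permutation $\pi$ of size $n$ is the permutation $\sigma$ of size $m$ with $\sigma(i)<\sigma(i')$ iff $\pi(k_i)<\pi(k_{i'})$. -}

module Defs where

open import Data.Nat using (ℕ; zero; suc; _+_; _≤_; _<_)
open import Data.Fin using (Fin; toℕ; splitAt; _↑ˡ_; _↑ʳ_; cast)
open import Data.Fin.Subset using (Subset; _∈_; _∉_)
open import Data.Sum using (_⊎_; inj₁; inj₂; [_,_])
open import Data.Product using (Σ; ∃; ∃-syntax; _×_; _,_)
open import Data.List using (List; []; _∷_; length; map; drop; take; tabulate; lookup)
open import Data.List.Relation.Unary.All using (All)
open import Data.List.Relation.Binary.Lex.Strict using (Lex-<)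
open import Function.Definitions using (Bijective)
open import Function.Bundles using (_⇔_)
open import Relation.Binary.PropositionalEquality using (_≡_; _≢_; sym)
open import Relation.Nullary using (¬_)

-- A permutation of size n is a bijection [n] → [n]  (here Fin n = {0,…,n-1}).
record Perm : Set where
  constructor perm
  field
    size : ℕ
    fun  : Fin size → Fin size
    bij  : Bijective _≡_ _≡_ fun
open Perm public

_⊕ᶠ_ : ∀ {a b} → (Fin a → Fin a) → (Fin b → Fin b) → Fin (a + b) → Fin (a + b)
_⊕ᶠ_ {a} {b} f g k = [ (λ i → f i ↑ˡ b) , (λ j → a ↑ʳ g j) ] (splitAt a k)

sumSize : List Perm → ℕ
sumSize []       = 0
sumSize (p ∷ ps) = size p + sumSize ps

sumFun : (ps : List Perm) → Fin (sumSize ps) → Fin (sumSize ps)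
sumFun []       = λ ()
sumFun (p ∷ ps) = fun p ⊕ᶠ sumFun ps

IsSumOf : Perm → List Perm → Set
IsSumOf π ps = Σ (sumSize ps ≡ size π) λ eq →
  ∀ (i : Fin (size π)) → toℕ (fun π i) ≡ toℕ (sumFun ps (cast (sym eq) i))

Decomposable : Perm → Set
Decomposable π = ∃[ σ ] ∃[ τ ] (0 < size σ × 0 < size τ × IsSumOf π (σ ∷ τ ∷ []))

-- Indecomposable permutations (the letters of Σ; of positive size).
Indecomposable : Perm → Set
Indecomposable π = 0 < size π × ¬ Decomposable π

IsBlockWord : Perm → List Perm → Set
IsBlockWord π ws = All Indecomposable ws × IsSumOf π ws

oneLine : Perm → List ℕ
oneLine p = tabulate (λ i → toℕ (fun p i))

_≈Σ_ : Perm → Perm → Set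
p ≈Σ q = oneLine p ≡ oneLine q

_<Σ_ : Perm → Perm → Set
p <Σ q = size p < size q ⊎ (size p ≡ size q × Lex-< _≡_ _<_ (oneLine p) (oneLine q))

_<W_ : List Perm → List Perm → Set
_<W_ = Lex-< _≈Σ_ _<Σ_

LyndonWord : List Perm → Set
LyndonWord w = 0 < length w × (∀ k → 0 < k → k < length w → w <W drop k w)

Lyndon : Perm → Set
Lyndon π = ∃[ w ] (IsBlockWord π w × LyndonWord w)

_>L_ : Perm → Perm → Set
π >L π' = ∃[ w ] ∃[ w' ] (IsBlockWord π w × IsBlockWord π' w' × w' <W w)

-- The pattern induced by J in the function f (on Fin N) is σ:
-- J = {k₀ < ⋯ < k_{m-1}} with m = |σ|, and σ(i) < σ(i') iff f(k_i) < f(k_i').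
PatternIs : ∀ {N} → (Fin N → Fin N) → Subset N → Perm → Set
PatternIs {N} f J σ = Σ (Fin (size σ) → Fin N) λ k →
    (∀ i i' → toℕ i < toℕ i' → toℕ (k i) < toℕ (k i'))
  × (∀ x → (x ∈ J) ⇔ (∃[ i ] k i ≡ x))
  × (∀ i i' → (toℕ (fun σ i) < toℕ (fun σ i')) ⇔ (toℕ (f (k i)) < toℕ (f (k i'))))

IsInterval : ∀ {N} → Subset N → Set
IsInterval {N} J = ∀ (x y z : Fin N) → x ∈ J → z ∈ J → toℕ x ≤ toℕ y → toℕ y ≤ toℕ z → y ∈ J

PairwiseDisjoint : ∀ {n N} → (Fin n → Subset N) → Set
PairwiseDisjoint {n} {N} J = ∀ (i i' : Fin n) → i ≢ i' → ∀ (x : Fin N) → x ∈ J i → x ∉ J i'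

module Submission where

-- Write each πᵢ as the Lyndon word wᵢ of its indecomposable blocks; the sum is then
-- the word L = w₁ ⋯ wₙ. By counting, the occurrences of the πᵢ on the disjoint Jᵢ
-- assemble into a bijection Φ of [N] sending the summand πᵢ onto Jᵢ. Φ maps each
-- letter of L into a single letter, since a cut inside an indecomposable would
-- decompose it; counting letters, Φ permutes the letters, so every letter of L lies
-- inside a single Jᵢ, and by uniqueness of block words the letters inside Jᵢ spell wᵢ.
-- Thus L is an interleaving of w₁ > ⋯ > wₙ. In any labelling of a Lyndon word some
-- label is dominant (its subword is not smaller than the word), by induction along
-- the standard factorisation; a dominant label of the first word w₁ can only be the
-- label of w₁, as the later words are smaller. Hence the interleaving is the
-- concatenation, and Jᵢ is the i-th summand.

open import Defs hiding (_<W_)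

open import Level using (0ℓ)
open import Function using (_∘_; id)
open import Function.Definitions using (Injective; Surjective)
open import Function.Bundles using (_⇔_; mk⇔; Equivalence)
open import Data.Product using (Σ; ∃; _×_; _,_; proj₁; proj₂)
open import Data.Sum using (_⊎_; inj₁; inj₂)
open import Relation.Nullary using (¬_; yes; no; contradiction)
open import Relation.Binary.Core using (Rel)
open import Relation.Binary.Structures using (IsStrictTotalOrder; IsEquivalence)
open import Relation.Binary.Definitions using (Tri; tri<; tri≈; tri>)
open import Relation.Binary.Consequences using (tri⇒dec<)
open import Relation.Binary.PropositionalEquality

open import Data.Nat using (ℕ; zero; suc; _+_; _∸_; _≤_; _<_; _≟_; s≤s; z≤n; s<s; z<s; _<?_; _≤?_)
open import Data.Nat.Properties
open import Data.Nat.ListAction using (sum)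
open import Data.Fin using (Fin; toℕ; fromℕ<; splitAt; _↑ˡ_; _↑ʳ_; cast; punchOut)
open import Data.Fin.Properties
  using (toℕ-injective; toℕ-↑ˡ; toℕ-↑ʳ; toℕ<n; fromℕ<-toℕ; toℕ-fromℕ<; toℕ-cast; splitAt⁻¹-↑ˡ; splitAt⁻¹-↑ʳ;
         injective⇒≤; any?; punchOut-injective)
  renaming (_≟_ to _≟ᶠ_)
open import Data.Fin.Subset using (Subset; _∈_)

open import Data.List using (List; []; _∷_; _++_; length; map; concat; take; drop; replicate; lookup; tabulate; applyUpTo)
open import Data.List.Properties
  using (take-[]; length-++; take++drop≡id; length-take; length-drop; drop-drop; ++-assoc; ∷-injectiveˡ; ∷-injectiveʳ;
         length-map; map-++; take-map; drop-map; tabulate-cong; length-tabulate; length-replicate)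
open import Data.List.Relation.Unary.Any using (Any; here; there)
open import Data.List.Relation.Unary.Any.Properties using (++⁺ˡ; ++⁺ʳ)
open import Data.List.Relation.Unary.All using (All; []; _∷_)
import Data.List.Relation.Unary.All.Properties as All
open import Data.List.Relation.Unary.AllPairs using (AllPairs; []; _∷_)
open import Data.List.Relation.Unary.Linked using (Linked; []; [-]; _∷_)
open import Data.List.Relation.Unary.Linked.Properties using (Linked⇒AllPairs)
open import Data.List.Relation.Binary.Pointwise using (Pointwise; []; _∷_; Pointwise-length; ++⁺; Pointwise-≡⇒≡; ≡⇒Pointwise-≡)
open import Data.List.Relation.Binary.Lex.Strict using (Lex-<; halt; this; next; xs≮[])
import Data.List.Relation.Binary.Lex.Strict as Lex

-- Consecutive blocks of ℕ

at : List ℕ → ℕ → ℕ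
at []       _       = 0
at (a ∷ as) zero    = a
at (a ∷ as) (suc j) = at as j

offset : List ℕ → ℕ → ℕ
offset as j = sum (take j as)

blockOf : List ℕ → ℕ → ℕ
blockOf []       x = 0
blockOf (a ∷ as) x with x <? a
... | yes _ = 0
... | no  _ = suc (blockOf as (x ∸ a))

blockOf-< : ∀ a as {x} → x < a → blockOf (a ∷ as) x ≡ 0
blockOf-< a as {x} x<a with x <? a
... | yes _   = refl
... | no  x≮a = contradiction x<a x≮a

blockOf-≥ : ∀ a as {x} → a ≤ x → blockOf (a ∷ as) x ≡ suc (blockOf as (x ∸ a))
blockOf-≥ a as {x} a≤x with x <? a
... | yes x<a = contradiction a≤x (<⇒≱ x<a)
... | no  _   = refl

blockOf-+ : ∀ a as y → blockOf (a ∷ as) (a + y) ≡ suc (blockOf as y)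
blockOf-+ a as y = trans (blockOf-≥ a as (m≤m+n a y)) (cong (suc ∘ blockOf as) (m+n∸m≡n a y))

∸-<-+ : ∀ {x a s} → a ≤ x → x < a + s → x ∸ a < s
∸-<-+ {x} {a} a≤x x<a+s = +-cancelˡ-< a _ _ (subst (_< a + _) (sym (m+[n∸m]≡n a≤x)) x<a+s)

blockOf<length : ∀ as {x} → x < sum as → blockOf as x < length as
blockOf<length (a ∷ as) {x} x<Σ with <-≤-connex x a
... | inj₁ x<a = subst (_< suc (length as)) (sym (blockOf-< a as x<a)) z<s
... | inj₂ a≤x = subst (_< suc (length as)) (sym (blockOf-≥ a as a≤x))
                       (s<s (blockOf<length as (∸-<-+ a≤x x<Σ)))

offset-blockOf≤ : ∀ as x → offset as (blockOf as x) ≤ x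
offset-blockOf≤ []       x = z≤n
offset-blockOf≤ (a ∷ as) x with <-≤-connex x a
... | inj₁ x<a rewrite blockOf-< a as x<a = z≤n
... | inj₂ a≤x rewrite blockOf-≥ a as a≤x =
  subst (a + offset as (blockOf as (x ∸ a)) ≤_) (m+[n∸m]≡n a≤x)
        (+-monoʳ-≤ a (offset-blockOf≤ as (x ∸ a)))

<offset-blockOf+at : ∀ as {x} → x < sum as → x < offset as (blockOf as x) + at as (blockOf as x)
<offset-blockOf+at (a ∷ as) {x} x<Σ with <-≤-connex x a
... | inj₁ x<a rewrite blockOf-< a as x<a = x<a
... | inj₂ a≤x rewrite blockOf-≥ a as a≤x =
  subst (_< a + offset as j + at as j) (m+[n∸m]≡n a≤x)
        (subst (a + (x ∸ a) <_) (sym (+-assoc a _ _))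
               (+-monoʳ-< a (<offset-blockOf+at as (∸-<-+ a≤x x<Σ))))
  where j = blockOf as (x ∸ a)

blockOf-offset+ : ∀ as j d → j < length as → d < at as j → blockOf as (offset as j + d) ≡ j
blockOf-offset+ (a ∷ as) zero    d _         d<a = blockOf-< a as d<a
blockOf-offset+ (a ∷ as) (suc j) d (s≤s j<l) d<a =
  trans (cong (blockOf (a ∷ as)) (+-assoc a (offset as j) d))
        (trans (blockOf-+ a as _) (cong suc (blockOf-offset+ as j d j<l d<a)))

blockOf-unique : ∀ as j {x} → j < length as → offset as j ≤ x → x < offset as j + at as j →
                 blockOf as x ≡ j
blockOf-unique as j j<l le lt =
  trans (cong (blockOf as) (sym (m+[n∸m]≡n le))) (blockOf-offset+ as j _ j<l (∸-<-+ le lt))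

blockOf-mono-≤ : ∀ as {x y} → x ≤ y → blockOf as x ≤ blockOf as y
blockOf-mono-≤ []       _ = z≤n
blockOf-mono-≤ (a ∷ as) {x} {y} x≤y with <-≤-connex x a
... | inj₁ x<a rewrite blockOf-< a as x<a = z≤n
... | inj₂ a≤x rewrite blockOf-≥ a as a≤x | blockOf-≥ a as (≤-trans a≤x x≤y) =
  s≤s (blockOf-mono-≤ as (∸-monoˡ-≤ a x≤y))

offset-suc : ∀ as j → j < length as → offset as (suc j) ≡ offset as j + at as j
offset-suc (a ∷ as) zero    _         = +-comm a 0
offset-suc (a ∷ as) (suc j) (s≤s j<l) = trans (cong (a +_) (offset-suc as j j<l)) (sym (+-assoc a _ _))

offset-length : ∀ as → offset as (length as) ≡ sum as
offset-length []       = refl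
offset-length (a ∷ as) = cong (a +_) (offset-length as)

offset-mono-≤ : ∀ as {i j} → i ≤ j → offset as i ≤ offset as j
offset-mono-≤ []       {i} {j} _ rewrite take-[] {A = ℕ} i | take-[] {A = ℕ} j = z≤n
offset-mono-≤ (a ∷ as) {zero}  {j}     _       = z≤n
offset-mono-≤ (a ∷ as) {suc i} {suc j} (s≤s h) = +-monoʳ-≤ a (offset-mono-≤ as h)

∸offset<at : ∀ as {x} → x < sum as → x ∸ offset as (blockOf as x) < at as (blockOf as x)
∸offset<at as x<Σ = ∸-<-+ (offset-blockOf≤ as _) (<offset-blockOf+at as x<Σ)

at-blockOf>0 : ∀ as {x} → x < sum as → 0 < at as (blockOf as x)
at-blockOf>0 as x<Σ = ≤-<-trans z≤n (∸offset<at as x<Σ)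

blockOf-offset : ∀ as {x} → x < sum as → blockOf as (offset as (blockOf as x)) ≡ blockOf as x
blockOf-offset as {x} x<Σ = trans (cong (blockOf as) (sym (+-identityʳ _)))
                                  (blockOf-offset+ as (blockOf as x) 0 (blockOf<length as x<Σ) (at-blockOf>0 as x<Σ))

-- Lyndon words and labelled words

module Words {A : Set} {_≈_ _≺_ : Rel A 0ℓ} (≺-isSTO : IsStrictTotalOrder _≈_ _≺_) where

  open IsStrictTotalOrder ≺-isSTO using () renaming (isEquivalence to ≈-isEquivalence; irrefl to ≺-irrefl)
  open IsEquivalence ≈-isEquivalence using () renaming (refl to ≈-refl; sym to ≈-sym)

  _<W_ : Rel (List A) 0ℓ
  _<W_ = Lex-< _≈_ _≺_

  _≋_ : Rel (List A) 0ℓ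
  _≋_ = Pointwise _≈_

  open IsStrictTotalOrder (Lex.<-isStrictTotalOrder ≺-isSTO) public
    using ()
    renaming (trans to <W-trans; irrefl to <W-irrefl; compare to <W-cmp; asym to <W-asym;
              <-resp-≈ to <W-resp-≋; isEquivalence to ≋-isEquivalence)
  open IsEquivalence ≋-isEquivalence public using () renaming (refl to ≋-refl; sym to ≋-sym)

  <W-respʳ-≋ : ∀ {x y z} → y ≋ z → x <W y → x <W z
  <W-respʳ-≋ = proj₁ <W-resp-≋

  <W-respˡ-≋ : ∀ {x y z} → y ≋ z → y <W x → z <W x
  <W-respˡ-≋ = proj₂ <W-resp-≋

  ≋-take : ∀ k {a b} → a ≋ b → take k a ≋ take k b
  ≋-take zero    _       = []
  ≋-take (suc k) []      = []
  ≋-take (suc k) (e ∷ p) = e ∷ ≋-take k p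

  ≋-drop : ∀ k {a b} → a ≋ b → drop k a ≋ drop k b
  ≋-drop zero    p       = p
  ≋-drop (suc k) []      = []
  ≋-drop (suc k) (_ ∷ p) = ≋-drop k p

  ≡⇒≋ : ∀ {a b} → a ≡ b → a ≋ b
  ≡⇒≋ refl = ≋-refl

  prefix-<W : ∀ xs {y ys} → xs <W (xs ++ y ∷ ys)
  prefix-<W []       = halt
  prefix-<W (x ∷ xs) = next ≈-refl (prefix-<W xs)

  ++-≮W : ∀ xs ys → ¬ ((xs ++ ys) <W xs)
  ++-≮W []       ys r          = xs≮[] r
  ++-≮W (x ∷ xs) ys (this r)   = ≺-irrefl ≈-refl r
  ++-≮W (x ∷ xs) ys (next _ r) = ++-≮W xs ys r

  <W-cancelˡ-++ : ∀ s {x y} → (s ++ x) <W (s ++ y) → x <W y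
  <W-cancelˡ-++ []      r          = r
  <W-cancelˡ-++ (c ∷ s) (this r)   = contradiction r (≺-irrefl ≈-refl)
  <W-cancelˡ-++ (c ∷ s) (next _ r) = <W-cancelˡ-++ s r

  data Mismatch : Rel (List A) 0ℓ where
    this : ∀ {x xs y ys} → x ≺ y → Mismatch (x ∷ xs) (y ∷ ys)
    next : ∀ {x xs y ys} → x ≈ y → Mismatch xs ys → Mismatch (x ∷ xs) (y ∷ ys)

  Mismatch⇒<W : ∀ {a b} → Mismatch a b → a <W b
  Mismatch⇒<W (this r)   = this r
  Mismatch⇒<W (next e d) = next e (Mismatch⇒<W d)

  Mismatch-++ : ∀ {a b} → Mismatch a b → ∀ c d → Mismatch (a ++ c) (b ++ d)
  Mismatch-++ (this r)   c d = this r
  Mismatch-++ (next e p) c d = next e (Mismatch-++ p c d)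

  <W⇒Mismatch⊎prefix : ∀ {a b} → a <W b → Mismatch a b ⊎ ∃ λ t → 0 < length t × b ≋ (a ++ t)
  <W⇒Mismatch⊎prefix (halt {y} {ys}) = inj₂ (y ∷ ys , z<s , ≋-refl)
  <W⇒Mismatch⊎prefix (this r)        = inj₁ (this r)
  <W⇒Mismatch⊎prefix (next e r) with <W⇒Mismatch⊎prefix r
  ... | inj₁ d               = inj₁ (next e d)
  ... | inj₂ (t , t≢[] , q) = inj₂ (t , t≢[] , ≈-sym e ∷ q)

  ≮W⇒≋⊎Mismatch : ∀ {x v} → ¬ (x <W v) → length x ≤ length v → x ≋ v ⊎ Mismatch v x
  ≮W⇒≋⊎Mismatch {x} {v} x≮v |x|≤|v| with <W-cmp x v
  ... | tri< x<v _ _ = contradiction x<v x≮v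
  ... | tri≈ _ x≋v _ = inj₁ x≋v
  ... | tri> _ _ v<x with <W⇒Mismatch⊎prefix v<x
  ...   | inj₁ d               = inj₂ d
  ...   | inj₂ (t , t≢[] , q) = contradiction |x|≤|v| (<⇒≱ longer)
    where
    longer : length v < length x
    longer = begin-strict
      length v              ≡⟨ +-identityʳ _ ⟨
      length v + 0          <⟨ +-monoʳ-< (length v) t≢[] ⟩
      length v + length t   ≡⟨ length-++ v ⟨
      length (v ++ t)       ≡⟨ Pointwise-length q ⟨
      length x              ∎
      where open ≤-Reasoning

  IsLyndon : List A → Set
  IsLyndon w = 0 < length w × (∀ k → 0 < k → k < length w → w <W drop k w)

  IsLyndon-resp-≋ : ∀ {a b} → a ≋ b → IsLyndon a → IsLyndon b
  IsLyndon-resp-≋ {a} {b} a≋b (a≢[] , a<suffix) =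
    subst (0 <_) |a|≡|b| a≢[] ,
    λ k k>0 k<|b| → <W-respʳ-≋ (≋-drop k a≋b) (<W-respˡ-≋ a≋b (a<suffix k k>0 (subst (k <_) (sym |a|≡|b|) k<|b|)))
    where |a|≡|b| = Pointwise-length a≋b

  minimiser : (f : ℕ → List A) (m : ℕ) → 1 ≤ m →
              ∃ λ k → 1 ≤ k × k ≤ m × (∀ k′ → 1 ≤ k′ → k′ ≤ m → ¬ (f k′ <W f k))
  minimiser f (suc zero) _ =
    1 , ≤-refl , ≤-refl , λ k′ 1≤k′ k′≤1 → subst (λ j → ¬ (f j <W f 1)) (≤-antisym 1≤k′ k′≤1) (<W-irrefl ≋-refl)
  minimiser f (suc (suc m)) _ with minimiser f (suc m) (s≤s z≤n)
  ... | k , 1≤k , k≤m , k-min with tri⇒dec< <W-cmp (f (suc (suc m))) (f k)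
  ...   | yes new<k = suc (suc m) , s≤s z≤n , ≤-refl , new-min
    where
    new-min : ∀ k′ → 1 ≤ k′ → k′ ≤ suc (suc m) → ¬ (f k′ <W f (suc (suc m)))
    new-min k′ 1≤k′ k′≤ r with m≤n⇒m<n∨m≡n k′≤
    ... | inj₁ k′<  = k-min k′ 1≤k′ (≤-pred k′<) (<W-trans r new<k)
    ... | inj₂ refl = <W-irrefl ≋-refl r
  ...   | no new≮k = k , 1≤k , m≤n⇒m≤1+n k≤m , old-min
    where
    old-min : ∀ k′ → 1 ≤ k′ → k′ ≤ suc (suc m) → ¬ (f k′ <W f k)
    old-min k′ 1≤k′ k′≤ with m≤n⇒m<n∨m≡n k′≤
    ... | inj₁ k′<  = k-min k′ 1≤k′ (≤-pred k′<)
    ... | inj₂ refl = new≮k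

  drop-take++drop : ∀ j k (u : List A) → j ≤ k → drop j (take k u) ++ drop k u ≡ drop j u
  drop-take++drop zero    k       u       _       = take++drop≡id k u
  drop-take++drop (suc j) (suc k) []      _       = refl
  drop-take++drop (suc j) (suc k) (x ∷ u) (s≤s h) = drop-take++drop j k u h

  drop-length-++ : ∀ (s t : List A) → drop (length s) (s ++ t) ≡ t
  drop-length-++ []      t = refl
  drop-length-++ (x ∷ s) t = drop-length-++ s t

  take-length-++ : ∀ (s t : List A) → take (length s) (s ++ t) ≡ s
  take-length-++ []      t = refl
  take-length-++ (x ∷ s) t = cong (x ∷_) (take-length-++ s t)

  -- The Lyndon factor w is the least proper suffix of u = v w.
  standard-factorisation : ∀ u → IsLyndon u → 2 ≤ length u →
    ∃ λ k → 0 < k × k < length u × IsLyndon (take k u) × IsLyndon (drop k u)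
  standard-factorisation (_ ∷ []) _ (s≤s ())
  standard-factorisation u@(_ ∷ _ ∷ u′) (_ , u<drop) _ =
    k , 1≤k , k<|u| , (0<|v| , v<drop) , (0<|w| , w<drop)
    where
    m : ℕ
    m = suc (length u′)
    least = minimiser (λ k → drop k u) m (s≤s z≤n)
    k = proj₁ least
    1≤k : 1 ≤ k
    1≤k = proj₁ (proj₂ least)
    k≤m : k ≤ m
    k≤m = proj₁ (proj₂ (proj₂ least))
    k-least : ∀ k′ → 1 ≤ k′ → k′ ≤ m → ¬ (drop k′ u <W drop k u)
    k-least = proj₂ (proj₂ (proj₂ least))
    k<|u| : k < length u
    k<|u| = s≤s k≤m
    v = take k u
    w = drop k u
    |v|≡k : length v ≡ k
    |v|≡k = trans (length-take k u) (m≤n⇒m⊓n≡m (<⇒≤ k<|u|))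
    0<|v| : 0 < length v
    0<|v| = subst (0 <_) (sym |v|≡k) 1≤k
    0<|w| : 0 < length w
    0<|w| = subst (0 <_) (sym (length-drop k u)) (m<n⇒0<n∸m k<|u|)

    w<drop : ∀ j → 0 < j → j < length w → w <W drop j w
    w<drop j 0<j j<|w| = subst (w <W_) (sym (drop-drop k j u)) w<drop[k+j]
      where
      k+j<|u| : k + j < length u
      k+j<|u| = subst (k + j <_) (m+[n∸m]≡n (<⇒≤ k<|u|)) (+-monoʳ-< k (subst (j <_) (length-drop k u) j<|w|))
      shorter : length (drop (k + j) u) < length w
      shorter = subst₂ _<_ (sym (length-drop (k + j) u)) (sym (length-drop k u))
                       (∸-monoʳ-< (m<m+n k 0<j) (<⇒≤ k+j<|u|))
      w<drop[k+j] : w <W drop (k + j) u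
      w<drop[k+j] with <W-cmp w (drop (k + j) u)
      ... | tri< r _ _ = r
      ... | tri≈ _ e _ = contradiction (Pointwise-length e) (>⇒≢ shorter)
      ... | tri> _ _ r = contradiction r (k-least (k + j) (≤-trans 1≤k (m≤m+n k j)) (≤-pred k+j<|u|))

    v<drop : ∀ j → 0 < j → j < length v → v <W drop j v
    v<drop j 0<j j<|v| = v<s
      where
      j<k = subst (j <_) |v|≡k j<|v|
      s = drop j v
      |s|≡k∸j : length s ≡ k ∸ j
      |s|≡k∸j = trans (length-drop j v) (cong (_∸ j) |v|≡k)
      vw<sw : (v ++ w) <W (s ++ w)
      vw<sw = subst₂ _<W_ (sym (take++drop≡id k u)) (sym (drop-take++drop j k u (<⇒≤ j<k)))
                     (u<drop j 0<j (<-trans j<k k<|u|))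
      v<s : v <W s
      v<s with <W-cmp v s
      ... | tri< r _ _ = r
      ... | tri≈ _ e _ = contradiction (trans (Pointwise-length e) |s|≡k∸j)
                                       (<⇒≢ (subst (k ∸ j <_) (sym |v|≡k) (∸-monoʳ-< 0<j (<⇒≤ j<k))) ∘ sym)
      ... | tri> _ _ s<v with <W⇒Mismatch⊎prefix s<v
      ...   | inj₁ d = contradiction (Mismatch⇒<W (Mismatch-++ d w w)) (<W-asym vw<sw)
      ...   | inj₂ (t , _ , v≋st) =
        contradiction drop[k∸j]<w (k-least (k ∸ j) (m<n⇒0<n∸m j<k) (≤-trans (m∸n≤m k j) k≤m))
        where
        tw<w : (t ++ w) <W w
        tw<w = <W-cancelˡ-++ s (<W-respˡ-≋ (subst ((v ++ w) ≋_) (++-assoc s t w) (++⁺ v≋st ≋-refl)) vw<sw)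
        drop[k∸j]v≋t : drop (k ∸ j) v ≋ t
        drop[k∸j]v≋t = subst₂ _≋_ (cong (λ z → drop z v) |s|≡k∸j) (drop-length-++ s t) (≋-drop (length s) v≋st)
        drop[k∸j]<w : drop (k ∸ j) u <W w
        drop[k∸j]<w = <W-respˡ-≋ (≋-sym (subst (_≋ (t ++ w)) (drop-take++drop (k ∸ j) k u (m∸n≤m k j))
                                                       (++⁺ drop[k∸j]v≋t ≋-refl)))
                                  tw<w

  Labelled : Set
  Labelled = List (A × ℕ)

  letters : Labelled → List A
  letters = map proj₁

  labels : Labelled → List ℕ
  labels = map proj₂

  subword : ℕ → Labelled → List A
  subword c []             = []
  subword c ((a , l) ∷ zs) with l ≟ c
  ... | yes _ = a ∷ subword c zs
  ... | no  _ = subword c zs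

  Occurs : ℕ → Labelled → Set
  Occurs c = Any ((_≡ c) ∘ proj₂)

  subword-++ : ∀ c xs ys → subword c (xs ++ ys) ≡ subword c xs ++ subword c ys
  subword-++ c []             ys = refl
  subword-++ c ((a , l) ∷ xs) ys with l ≟ c
  ... | yes _ = cong (a ∷_) (subword-++ c xs ys)
  ... | no  _ = subword-++ c xs ys

  subword-here : ∀ a l zs → subword l ((a , l) ∷ zs) ≡ a ∷ subword l zs
  subword-here a l zs with l ≟ l
  ... | yes _  = refl
  ... | no l≢l = contradiction refl l≢l

  length-subword≤ : ∀ c zs → length (subword c zs) ≤ length zs
  length-subword≤ c []             = z≤n
  length-subword≤ c ((a , l) ∷ zs) with l ≟ c
  ... | yes _ = s≤s (length-subword≤ c zs)
  ... | no  _ = m≤n⇒m≤1+n (length-subword≤ c zs)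

  subword≢[]⇒Occurs : ∀ c zs → 0 < length (subword c zs) → Occurs c zs
  subword≢[]⇒Occurs c ((a , l) ∷ zs) h with l ≟ c
  ... | yes l≡c = here l≡c
  ... | no  _   = there (subword≢[]⇒Occurs c zs h)

  ¬Occurs⇒subword≡[] : ∀ c zs → ¬ Occurs c zs → subword c zs ≡ []
  ¬Occurs⇒subword≡[] c []             _ = refl
  ¬Occurs⇒subword≡[] c ((a , l) ∷ zs) h with l ≟ c
  ... | yes l≡c = contradiction (here l≡c) h
  ... | no  _   = ¬Occurs⇒subword≡[] c zs (h ∘ there)

  Occurs⇒subword≢[] : ∀ c zs → Occurs c zs → 0 < length (subword c zs)
  Occurs⇒subword≢[] c ((a , l) ∷ zs) (here refl) rewrite subword-here a l zs = z<s
  Occurs⇒subword≢[] c ((a , l) ∷ zs) (there p) with l ≟ c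
  ... | yes _ = z<s
  ... | no  _ = Occurs⇒subword≢[] c zs p

  full-subword⇒labels≡replicate : ∀ c zs → length (subword c zs) ≡ length zs → labels zs ≡ replicate (length zs) c
  full-subword⇒labels≡replicate c []             _ = refl
  full-subword⇒labels≡replicate c ((a , l) ∷ zs) e with l ≟ c
  ... | yes refl = cong (l ∷_) (full-subword⇒labels≡replicate c zs (suc-injective e))
  ... | no  _    = contradiction e (<⇒≢ (s≤s (length-subword≤ c zs)))

  Occurs-replicate : ∀ {c d} zs → labels zs ≡ replicate (length zs) c → Occurs d zs → d ≡ c
  Occurs-replicate ((a , l) ∷ zs) e (here refl) = ∷-injectiveˡ e
  Occurs-replicate ((a , l) ∷ zs) e (there p)   = Occurs-replicate zs (∷-injectiveʳ e) p

  Occurs-take : ∀ {c} k zs → Occurs c (take k zs) → Occurs c zs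
  Occurs-take (suc k) (x ∷ zs) (here p)  = here p
  Occurs-take (suc k) (x ∷ zs) (there p) = there (Occurs-take k zs p)

  Occurs-drop : ∀ {c} k zs → Occurs c (drop k zs) → Occurs c zs
  Occurs-drop zero    zs       p = p
  Occurs-drop (suc k) (x ∷ zs) p = there (Occurs-drop k zs p)

  Dominant : Labelled → ℕ → Set
  Dominant zs c = Occurs c zs × ¬ (subword c zs <W letters zs)

  -- For u = v w Lyndon with u < w: a dominant label of w that does not occur in v
  -- works for u; otherwise a dominant label of v either beats v at a mismatch,
  -- or labels all of v and then also occurs in w.
  Dominant-++ : ∀ zs₁ zs₂ → letters (zs₁ ++ zs₂) <W letters zs₂ →
                ∃ (Dominant zs₁) → ∃ (Dominant zs₂) → ∃ (Dominant (zs₁ ++ zs₂))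
  Dominant-++ zs₁ zs₂ u<w (d , d∈ , d-dom) (c , c∈ , c-dom) with subword c zs₁ in eq
  ... | [] = c , ++⁺ʳ zs₁ c∈ , λ r → c-dom (<W-trans (subst (_<W u) sub[c]≡ r) u<w)
    where
    u = letters (zs₁ ++ zs₂)
    sub[c]≡ : subword c (zs₁ ++ zs₂) ≡ subword c zs₂
    sub[c]≡ = trans (subword-++ c zs₁ zs₂) (cong (_++ subword c zs₂) eq)
  ... | _ ∷ _ with ≮W⇒≋⊎Mismatch d-dom (subst (length (subword d zs₁) ≤_) (sym (length-map proj₁ zs₁))
                                                (length-subword≤ d zs₁))
  ...   | inj₂ mismatch = d , ++⁺ˡ d∈ , λ r → <W-asym r
    (subst₂ _<W_ (sym (map-++ proj₁ zs₁ zs₂)) (sym (subword-++ d zs₁ zs₂))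
            (Mismatch⇒<W (Mismatch-++ mismatch (letters zs₂) (subword d zs₂))))
  ...   | inj₁ full = c , ++⁺ʳ zs₁ c∈ , λ r → c-dom (<W-cancelˡ-++ v
    (<W-respˡ-≋ sub[c]≋ (subst₂ _<W_ (subword-++ c zs₁ zs₂) (map-++ proj₁ zs₁ zs₂) r)))
    where
    v = letters zs₁
    c≡d : c ≡ d
    c≡d = Occurs-replicate zs₁ (full-subword⇒labels≡replicate d zs₁ (trans (Pointwise-length full) (length-map proj₁ zs₁)))
                           (subword≢[]⇒Occurs c zs₁ (subst ((0 <_) ∘ length) (sym eq) z<s))
    sub[c]≋ : (subword c zs₁ ++ subword c zs₂) ≋ (v ++ subword c zs₂)
    sub[c]≋ = ++⁺ (subst (λ z → subword z zs₁ ≋ v) (sym c≡d) full) ≋-refl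

  ∃Dominant-bounded : ∀ n zs → length zs ≤ n → IsLyndon (letters zs) → ∃ (Dominant zs)
  ∃Dominant-bounded n       ((a , l) ∷ []) _ _ = l , here refl , λ r → <W-irrefl ≋-refl (subst (_<W (a ∷ [])) (subword-here a l []) r)
  ∃Dominant-bounded (suc n) zs@(_ ∷ _ ∷ _) |zs|≤ lyndon =
    subst (∃ ∘ Dominant) (take++drop≡id k zs)
          (Dominant-++ (take k zs) (drop k zs) u<w
                       (∃Dominant-bounded n (take k zs) |take|≤n (subst IsLyndon (take-map k zs) v-lyndon))
                       (∃Dominant-bounded n (drop k zs) |drop|≤n (subst IsLyndon (drop-map k zs) w-lyndon)))
    where
    factorisation = standard-factorisation (letters zs) lyndon (s≤s (s≤s z≤n))
    k = proj₁ factorisation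
    0<k = proj₁ (proj₂ factorisation)
    k<|zs| : k < length zs
    k<|zs| = subst (k <_) (length-map proj₁ zs) (proj₁ (proj₂ (proj₂ factorisation)))
    v-lyndon = proj₁ (proj₂ (proj₂ (proj₂ factorisation)))
    w-lyndon = proj₂ (proj₂ (proj₂ (proj₂ factorisation)))
    |take|≤n : length (take k zs) ≤ n
    |take|≤n = ≤-pred (≤-trans (s≤s (≤-reflexive (trans (length-take k zs) (m≤n⇒m⊓n≡m (<⇒≤ k<|zs|)))))
                               (≤-trans k<|zs| |zs|≤))
    |drop|≤n : length (drop k zs) ≤ n
    |drop|≤n = ≤-pred (≤-trans (s≤s (≤-reflexive (length-drop k zs))) (≤-trans (∸-monoʳ-< 0<k (<⇒≤ k<|zs|)) |zs|≤))
    u<w : letters (take k zs ++ drop k zs) <W letters (drop k zs)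
    u<w = subst₂ _<W_ (cong letters (sym (take++drop≡id k zs))) (drop-map k zs)
                 (proj₂ lyndon k 0<k (subst (k <_) (sym (length-map proj₁ zs)) k<|zs|))

  ∃Dominant : ∀ zs → IsLyndon (letters zs) → ∃ (Dominant zs)
  ∃Dominant zs = ∃Dominant-bounded (length zs) zs ≤-refl

  canonicalLabels : ℕ → List (List A) → List ℕ
  canonicalLabels b []       = []
  canonicalLabels b (u ∷ us) = replicate (length u) b ++ canonicalLabels (suc b) us

  nth : List (List A) → ℕ → List A
  nth []       _       = []
  nth (u ∷ us) zero    = u
  nth (u ∷ us) (suc i) = nth us i

  All-nth : ∀ {P : List A → Set} us i → All P us → i < length us → P (nth us i)
  All-nth (u ∷ us) zero    (p ∷ _)  _         = p
  All-nth (u ∷ us) (suc i) (_ ∷ ps) (s≤s i<n) = All-nth us i ps i<n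

  letters≋[]⇒≡[] : ∀ zs → letters zs ≋ [] → zs ≡ []
  letters≋[]⇒≡[] [] _ = refl

  ≤⇒≡⊎+suc : ∀ {b c} → b ≤ c → c ≡ b ⊎ ∃ λ i → c ≡ b + suc i
  ≤⇒≡⊎+suc {b} {c} b≤c with m≤n⇒m<n∨m≡n b≤c
  ... | inj₂ b≡c = inj₁ (sym b≡c)
  ... | inj₁ b<c = inj₂ (c ∸ suc b , trans (sym (m+[n∸m]≡n b<c)) (sym (+-suc b (c ∸ suc b))))

  -- A dominant label c of the first factor u₀ must be b: the subword of a later
  -- label b + 1 + i is a prefix of uᵢ₊₁ < u₀. Then the subword of b is all of u₀.
  labels-canonical : ∀ us b zs → All IsLyndon us → AllPairs (λ u v → v <W u) us →
    letters zs ≋ concat us →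
    (∀ c → Occurs c zs → b ≤ c × c < b + length us) →
    (∀ i → i < length us → subword (b + i) zs ≋ nth us i) →
    labels zs ≡ canonicalLabels b us
  labels-canonical [] b zs _ _ zs≋[] _ _ rewrite letters≋[]⇒≡[] zs zs≋[] = refl
  labels-canonical (u ∷ us) b zs (u-lyndon ∷ us-lyndon) (us<u ∷ us-desc) zs≋ bounds subwords =
    begin
      labels zs                              ≡⟨ cong labels (take++drop≡id k zs) ⟨
      labels (zs₁ ++ zs₂)                    ≡⟨ map-++ proj₂ zs₁ zs₂ ⟩
      labels zs₁ ++ labels zs₂               ≡⟨ cong₂ _++_ (trans zs₁-all-b (cong (λ z → replicate z b) |zs₁|≡k)) rest ⟩
      canonicalLabels b (u ∷ us)             ∎
    where
    open ≡-Reasoning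
    k = length u
    zs₁ = take k zs
    zs₂ = drop k zs
    zs₁≋u : letters zs₁ ≋ u
    zs₁≋u = subst (_≋ u) (take-map k zs) (subst (take k (letters zs) ≋_) (take-length-++ u (concat us)) (≋-take k zs≋))
    zs₂≋us : letters zs₂ ≋ concat us
    zs₂≋us = subst (_≋ concat us) (drop-map k zs) (subst (drop k (letters zs) ≋_) (drop-length-++ u (concat us)) (≋-drop k zs≋))
    |zs₁|≡k : length zs₁ ≡ k
    |zs₁|≡k = trans (sym (length-map proj₁ zs₁)) (Pointwise-length zs₁≋u)
    subword-split : ∀ c → subword c zs ≡ subword c zs₁ ++ subword c zs₂
    subword-split c = trans (cong (subword c) (sym (take++drop≡id k zs))) (subword-++ c zs₁ zs₂)

    later-subword<u : ∀ i → i < length us → subword (b + suc i) zs₁ <W u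
    later-subword<u i i<n with <W-cmp (subword (b + suc i) zs₁) (nth us i)
    ... | tri< r _ _ = <W-trans r (All-nth us i us<u i<n)
    ... | tri≈ _ e _ = <W-respˡ-≋ (≋-sym e) (All-nth us i us<u i<n)
    ... | tri> _ _ r = contradiction (<W-respˡ-≋ (≋-sym prefix) r) (++-≮W _ _)
      where
      prefix : (subword (b + suc i) zs₁ ++ subword (b + suc i) zs₂) ≋ nth us i
      prefix = subst (_≋ nth us i) (subword-split (b + suc i)) (subwords (suc i) (s≤s i<n))

    dominant = ∃Dominant zs₁ (IsLyndon-resp-≋ (≋-sym zs₁≋u) u-lyndon)
    c = proj₁ dominant
    c-bounds = bounds c (Occurs-take k zs (proj₁ (proj₂ dominant)))
    b-dominant : ¬ (subword b zs₁ <W letters zs₁)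
    b-dominant with ≤⇒≡⊎+suc (proj₁ c-bounds)
    ... | inj₁ c≡b       = subst (λ z → ¬ (subword z zs₁ <W letters zs₁)) c≡b (proj₂ (proj₂ dominant))
    ... | inj₂ (i , c≡) = contradiction (<W-respʳ-≋ (≋-sym zs₁≋u) (later-subword<u i i<n))
                                        (subst (λ z → ¬ (subword z zs₁ <W letters zs₁)) c≡ (proj₂ (proj₂ dominant)))
      where
      i<n : i < length us
      i<n = ≤-pred (+-cancelˡ-< b (suc i) (suc (length us)) (subst (_< b + suc (length us)) c≡ (proj₂ c-bounds)))

    sub[b]≋u : (subword b zs₁ ++ subword b zs₂) ≋ u
    sub[b]≋u = subst (_≋ u) (trans (cong (λ z → subword z zs) (+-identityʳ b)) (subword-split b)) (subwords 0 z<s)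
    sub[b]₂≡[] : subword b zs₂ ≡ []
    sub[b]₂≡[] with subword b zs₂ in eq
    ... | []    = refl
    ... | _ ∷ _ = contradiction
      (<W-respʳ-≋ (≋-sym zs₁≋u) (<W-respʳ-≋ (subst (λ z → (subword b zs₁ ++ z) ≋ u) eq sub[b]≋u) (prefix-<W _)))
                                b-dominant
    zs₁-all-b : labels zs₁ ≡ replicate (length zs₁) b
    zs₁-all-b = full-subword⇒labels≡replicate b zs₁ (begin
      length (subword b zs₁)                      ≡⟨ +-identityʳ _ ⟨
      length (subword b zs₁) + 0                  ≡⟨ cong ((length (subword b zs₁) +_) ∘ length) sub[b]₂≡[] ⟨
      length (subword b zs₁) + length (subword b zs₂) ≡⟨ length-++ (subword b zs₁) ⟨
      length (subword b zs₁ ++ subword b zs₂)     ≡⟨ Pointwise-length sub[b]≋u ⟩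
      k                                           ≡⟨ |zs₁|≡k ⟨
      length zs₁                                  ∎)

    rest : labels zs₂ ≡ canonicalLabels (suc b) us
    rest = labels-canonical us (suc b) zs₂ us-lyndon us-desc zs₂≋us bounds₂ subwords₂
      where
      bounds₂ : ∀ c → Occurs c zs₂ → suc b ≤ c × c < suc b + length us
      bounds₂ c c∈ = ≤∧≢⇒< (proj₁ c-bnd) b≢c
                   , subst (c <_) (+-suc b (length us)) (proj₂ c-bnd)
        where
        c-bnd = bounds c (Occurs-drop k zs c∈)
        b≢c : b ≢ c
        b≢c refl = contradiction (subst ((0 <_) ∘ length) sub[b]₂≡[] (Occurs⇒subword≢[] b zs₂ c∈)) (<-irrefl refl)
      subwords₂ : ∀ i → i < length us → subword (suc b + i) zs₂ ≋ nth us i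
      subwords₂ i i<n = subst (_≋ nth us i) (begin
          subword (b + suc i) zs                          ≡⟨ subword-split (b + suc i) ⟩
          subword (b + suc i) zs₁ ++ subword (b + suc i) zs₂ ≡⟨ cong (_++ subword (b + suc i) zs₂) not-in-zs₁ ⟩
          subword (b + suc i) zs₂                          ≡⟨ cong (λ z → subword z zs₂) (+-suc b i) ⟩
          subword (suc b + i) zs₂                          ∎)
        (subwords (suc i) (s≤s i<n))
        where
        not-in-zs₁ : subword (b + suc i) zs₁ ≡ []
        not-in-zs₁ = ¬Occurs⇒subword≡[] (b + suc i) zs₁ (λ p → m+1+n≢m b (Occurs-replicate zs₁ zs₁-all-b p))

-- Permutations, direct sums and cuts

-- Junk value 0 outside [0, size p).
funℕ : Perm → ℕ → ℕ
funℕ p x with x <? size p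
... | yes x<n = toℕ (fun p (fromℕ< x<n))
... | no  _   = 0

funℕ-< : ∀ p {x} (x<n : x < size p) → funℕ p x ≡ toℕ (fun p (fromℕ< x<n))
funℕ-< p {x} x<n with x <? size p
... | yes _   = refl
... | no  x≮n = contradiction x<n x≮n

funℕ-toℕ : ∀ p (i : Fin (size p)) → funℕ p (toℕ i) ≡ toℕ (fun p i)
funℕ-toℕ p i = trans (funℕ-< p (toℕ<n i)) (cong (toℕ ∘ fun p) (fromℕ<-toℕ i (toℕ<n i)))

funℕ<size : ∀ p {x} → x < size p → funℕ p x < size p
funℕ<size p x<n rewrite funℕ-< p x<n = toℕ<n _

funℕ-injective : ∀ p {x y} → x < size p → y < size p → funℕ p x ≡ funℕ p y → x ≡ y
funℕ-injective p {x} {y} x<n y<n e = begin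
  x                    ≡⟨ toℕ-fromℕ< x<n ⟨
  toℕ (fromℕ< x<n)     ≡⟨ cong toℕ (proj₁ (bij p) (toℕ-injective (begin
                            toℕ (fun p (fromℕ< x<n)) ≡⟨ funℕ-< p x<n ⟨
                            funℕ p x                 ≡⟨ e ⟩
                            funℕ p y                 ≡⟨ funℕ-< p y<n ⟩
                            toℕ (fun p (fromℕ< y<n)) ∎))) ⟩
  toℕ (fromℕ< y<n)     ≡⟨ toℕ-fromℕ< y<n ⟩
  y                    ∎
  where open ≡-Reasoning

funℕ-surjective : ∀ p {y} → y < size p → ∃ λ x → x < size p × funℕ p x ≡ y
funℕ-surjective p {y} y<n = toℕ i , toℕ<n i , trans (funℕ-toℕ p i) (trans (cong toℕ (proj₂ preimage refl)) (toℕ-fromℕ< y<n))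
  where
  preimage = proj₂ (bij p) (fromℕ< y<n)
  i = proj₁ preimage

-- Junk value: sumFunℕ ps is the identity past sumSize ps.
sumFunℕ : List Perm → ℕ → ℕ
sumFunℕ []       x = x
sumFunℕ (p ∷ ps) x with x <? size p
... | yes x<n = toℕ (fun p (fromℕ< x<n))
... | no  _   = size p + sumFunℕ ps (x ∸ size p)

sumFunℕ-< : ∀ p ps {x} → x < size p → sumFunℕ (p ∷ ps) x ≡ funℕ p x
sumFunℕ-< p ps {x} x<n = trans sumFunℕ≡fun (sym (funℕ-< p x<n))
  where
  sumFunℕ≡fun : sumFunℕ (p ∷ ps) x ≡ toℕ (fun p (fromℕ< x<n))
  sumFunℕ≡fun with x <? size p
  ... | yes _   = refl
  ... | no  x≮n = contradiction x<n x≮n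

sumFunℕ-≥ : ∀ p ps {x} → size p ≤ x → sumFunℕ (p ∷ ps) x ≡ size p + sumFunℕ ps (x ∸ size p)
sumFunℕ-≥ p ps {x} n≤x with x <? size p
... | yes x<n = contradiction n≤x (<⇒≱ x<n)
... | no  _   = refl

sumFunℕ-+ : ∀ p ps y → sumFunℕ (p ∷ ps) (size p + y) ≡ size p + sumFunℕ ps y
sumFunℕ-+ p ps y = trans (sumFunℕ-≥ p ps (m≤m+n (size p) y)) (cong ((size p +_) ∘ sumFunℕ ps) (m+n∸m≡n (size p) y))

toℕ-sumFun : ∀ ps (i : Fin (sumSize ps)) → toℕ (sumFun ps i) ≡ sumFunℕ ps (toℕ i)
toℕ-sumFun (p ∷ ps) i with splitAt (size p) i in eq
... | inj₁ j = begin
  toℕ (fun p j ↑ˡ sumSize ps)    ≡⟨ toℕ-↑ˡ (fun p j) (sumSize ps) ⟩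
  toℕ (fun p j)                  ≡⟨ funℕ-toℕ p j ⟨
  funℕ p (toℕ j)                 ≡⟨ sumFunℕ-< p ps (toℕ<n j) ⟨
  sumFunℕ (p ∷ ps) (toℕ j)       ≡⟨ cong (sumFunℕ (p ∷ ps)) i≡j ⟨
  sumFunℕ (p ∷ ps) (toℕ i)       ∎
  where
  open ≡-Reasoning
  i≡j : toℕ i ≡ toℕ j
  i≡j = trans (cong toℕ (sym (splitAt⁻¹-↑ˡ eq))) (toℕ-↑ˡ j (sumSize ps))
... | inj₂ j = begin
  toℕ (size p ↑ʳ sumFun ps j)        ≡⟨ toℕ-↑ʳ (size p) (sumFun ps j) ⟩
  size p + toℕ (sumFun ps j)         ≡⟨ cong (size p +_) (toℕ-sumFun ps j) ⟩
  size p + sumFunℕ ps (toℕ j)        ≡⟨ sumFunℕ-+ p ps (toℕ j) ⟨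
  sumFunℕ (p ∷ ps) (size p + toℕ j)  ≡⟨ cong (sumFunℕ (p ∷ ps)) i≡n+j ⟨
  sumFunℕ (p ∷ ps) (toℕ i)           ∎
  where
  open ≡-Reasoning
  i≡n+j : toℕ i ≡ size p + toℕ j
  i≡n+j = trans (cong toℕ (sym (splitAt⁻¹-↑ʳ eq))) (toℕ-↑ʳ (size p) j)

sumFunℕ<sumSize : ∀ ps {x} → x < sumSize ps → sumFunℕ ps x < sumSize ps
sumFunℕ<sumSize (p ∷ ps) {x} x<Σ with <-≤-connex x (size p)
... | inj₁ x<n rewrite sumFunℕ-< p ps x<n = <-≤-trans (funℕ<size p x<n) (m≤m+n (size p) (sumSize ps))
... | inj₂ n≤x rewrite sumFunℕ-≥ p ps n≤x = +-monoʳ-< (size p) (sumFunℕ<sumSize ps (∸-<-+ n≤x x<Σ))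

choose : ∀ {s} {P : ℕ → ℕ → Set} → (∀ a → a < s → Σ ℕ (P a)) → ℕ → ℕ
choose {s} H a with a <? s
... | yes a<s = proj₁ (H a a<s)
... | no  _   = 0

choose-spec : ∀ {s} {P : ℕ → ℕ → Set} (H : ∀ a → a < s → Σ ℕ (P a)) → ∀ a → a < s → P a (choose H a)
choose-spec {s} H a a<s with a <? s
... | yes a<s′ = proj₂ (H a a<s′)
... | no  a≮s  = contradiction a<s a≮s

toFin : ∀ {n m} (f : ℕ → ℕ) → (∀ x → x < n → f x < m) → Fin n → Fin m
toFin f f<m i = fromℕ< (f<m (toℕ i) (toℕ<n i))

toℕ-toFin : ∀ {n m} (f : ℕ → ℕ) (f<m : ∀ x → x < n → f x < m) i → toℕ (toFin f f<m i) ≡ f (toℕ i)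
toℕ-toFin f f<m i = toℕ-fromℕ< (f<m (toℕ i) (toℕ<n i))

BoundedInjective : (ℕ → ℕ) → ℕ → Set
BoundedInjective f n = ∀ x y → x < n → y < n → f x ≡ f y → x ≡ y

toFin-injective : ∀ {n m} (f : ℕ → ℕ) (f<m : ∀ x → x < n → f x < m) → BoundedInjective f n →
                  Injective _≡_ _≡_ (toFin f f<m)
toFin-injective f f<m f-inj {i} {j} e = toℕ-injective (f-inj _ _ (toℕ<n i) (toℕ<n j)
  (trans (sym (toℕ-toFin f f<m i)) (trans (cong toℕ e) (toℕ-toFin f f<m j))))

bounded-injection⇒≤ : ∀ {n m} (f : ℕ → ℕ) → (∀ x → x < n → f x < m) → BoundedInjective f n → n ≤ m
bounded-injection⇒≤ f f<m f-inj = injective⇒≤ (toFin-injective f f<m f-inj)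

-- A value missed by an injection of [0, N) into itself could be punched out of the codomain.
bounded-injection⇒surjective : ∀ {N} (f : ℕ → ℕ) → (∀ x → x < N → f x < N) → BoundedInjective f N →
                               ∀ y → y < N → ∃ λ x → x < N × f x ≡ y
bounded-injection⇒surjective {suc n} f f<N f-inj y y<N
  with any? (λ i → F i ≟ᶠ fromℕ< y<N)
  where F = toFin f f<N
... | yes (i , Fi≡y) = toℕ i , toℕ<n i , trans (sym (toℕ-toFin f f<N i)) (trans (cong toℕ Fi≡y) (toℕ-fromℕ< y<N))
... | no  y∉image = contradiction (injective⇒≤ {f = G} G-injective) 1+n≰n
  where
  F = toFin f f<N
  y≢F : ∀ i → fromℕ< y<N ≢ F i
  y≢F i y≡Fi = y∉image (i , sym y≡Fi)
  G : Fin (suc n) → Fin n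
  G i = punchOut (y≢F i)
  G-injective : Injective _≡_ _≡_ G
  G-injective {i} {j} e = toFin-injective f f<N f-inj (punchOut-injective (y≢F i) (y≢F j) e)

bounded-surjection⇒injective : ∀ {M} (f : ℕ → ℕ) → (∀ x → x < M → f x < M) →
                               (∀ j → j < M → ∃ λ x → x < M × f x ≡ j) → BoundedInjective f M
bounded-surjection⇒injective {M} f f<M f-surj g₁ g₂ g₁<M g₂<M fg₁≡fg₂ = begin
  g₁                    ≡⟨ proj₂ (proj₂ s₁) ⟨
  section (proj₁ s₁)    ≡⟨ cong section (trans (sym (f-through s₁)) (trans fg₁≡fg₂ (f-through s₂))) ⟩
  section (proj₁ s₂)    ≡⟨ proj₂ (proj₂ s₂) ⟩
  g₂                    ∎
  where
  open ≡-Reasoning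
  section = choose f-surj
  section-spec = choose-spec f-surj
  section-injective : BoundedInjective section M
  section-injective j j′ j<M j′<M e =
    trans (sym (proj₂ (section-spec j j<M))) (trans (cong f e) (proj₂ (section-spec j′ j′<M)))
  onto = bounded-injection⇒surjective section (λ j j<M → proj₁ (section-spec j j<M)) section-injective
  s₁ = onto g₁ g₁<M
  s₂ = onto g₂ g₂<M
  f-through : ∀ {g} (s : ∃ λ j → j < M × section j ≡ g) → f g ≡ proj₁ s
  f-through (j , j<M , refl) = proj₂ (section-spec j j<M)

Cut : (ℕ → ℕ) → ℕ → ℕ → Set
Cut f s t = ∀ a b → a < t → t ≤ b → b < s → f a < f b

module _ (τ : Perm) (t : ℕ) (0<t : 0 < t) (t<s : t < size τ) (cut : Cut (funℕ τ) (size τ) t) where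
  private
    s : ℕ
    s = size τ

    g : ℕ → ℕ
    g = funℕ τ

    r : ℕ
    r = s ∸ t

    preimage : ℕ → ℕ
    preimage = choose (λ _ → funℕ-surjective τ)

    preimage<s : ∀ {v} → v < s → preimage v < s
    preimage<s {v} v<s = proj₁ (choose-spec (λ _ → funℕ-surjective τ) v v<s)

    g-preimage : ∀ {v} → v < s → g (preimage v) ≡ v
    g-preimage {v} v<s = proj₂ (choose-spec (λ _ → funℕ-surjective τ) v v<s)

    -- otherwise preimage would inject [0, t] into [0, t)
    left-closed : ∀ a → a < t → g a < t
    left-closed a a<t with g a <? t
    ... | yes ga<t = ga<t
    ... | no  ga≮t = contradiction (bounded-injection⇒≤ {suc t} {t} preimage below inj) (<-irrefl refl)
      where
      v<s : ∀ {v} → v < suc t → v < s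
      v<s v≤t = ≤-<-trans (≤-pred v≤t) t<s
      below : ∀ v → v < suc t → preimage v < t
      below v v≤t with preimage v <? t
      ... | yes b<t = b<t
      ... | no  b≮t = contradiction (cut a (preimage v) a<t (≮⇒≥ b≮t) (preimage<s (v<s v≤t)))
                                    (≤⇒≯ (≤-trans (subst (_≤ t) (sym (g-preimage (v<s v≤t))) (≤-pred v≤t)) (≮⇒≥ ga≮t)))
      inj : ∀ x y → x < suc t → y < suc t → preimage x ≡ preimage y → x ≡ y
      inj x y x≤t y≤t e = trans (sym (g-preimage (v<s x≤t))) (trans (cong g e) (g-preimage (v<s y≤t)))

    -- otherwise g would inject [0, t) into [0, g b)
    right-closed : ∀ b → t ≤ b → b < s → t ≤ g b
    right-closed b t≤b b<s with t ≤? g b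
    ... | yes t≤gb = t≤gb
    ... | no  t≰gb = contradiction (bounded-injection⇒≤ {t} {g b} g (λ a a<t → cut a b a<t t≤b b<s)
                                      (λ x y x<t y<t → funℕ-injective τ (<-trans x<t t<s) (<-trans y<t t<s)))
                                   (<⇒≱ (≰⇒> t≰gb))

    t+y<s : ∀ {y} → y < r → t + y < s
    t+y<s {y} y<r = subst (t + y <_) (m+[n∸m]≡n (<⇒≤ t<s)) (+-monoʳ-< t y<r)

    fL : Fin t → Fin t
    fL i = fromℕ< (left-closed (toℕ i) (toℕ<n i))

    toℕ-fL : ∀ i → toℕ (fL i) ≡ g (toℕ i)
    toℕ-fL i = toℕ-fromℕ< (left-closed (toℕ i) (toℕ<n i))

    fL-injective : Injective _≡_ _≡_ fL
    fL-injective {i} {j} e = toℕ-injective (funℕ-injective τ (<-trans (toℕ<n i) t<s) (<-trans (toℕ<n j) t<s)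
      (trans (sym (toℕ-fL i)) (trans (cong toℕ e) (toℕ-fL j))))

    fL-surjective : Surjective _≡_ _≡_ fL
    fL-surjective y = fromℕ< x<t , λ { refl → toℕ-injective (trans (toℕ-fL _) (trans (cong g (toℕ-fromℕ< x<t)) gx≡y)) }
      where
      y<s = <-trans (toℕ<n y) t<s
      x = preimage (toℕ y)
      gx≡y : g x ≡ toℕ y
      gx≡y = g-preimage y<s
      x<t : x < t
      x<t with x <? t
      ... | yes x<t = x<t
      ... | no  x≮t = contradiction (subst (t ≤_) gx≡y (right-closed x (≮⇒≥ x≮t) (preimage<s y<s))) (<⇒≱ (toℕ<n y))

    σL : Perm
    σL = perm t fL (fL-injective , fL-surjective)

    fR-bound : ∀ y → y < r → g (t + y) ∸ t < r
    fR-bound y y<r = ∸-monoˡ-< (funℕ<size τ (t+y<s y<r)) (right-closed (t + y) (m≤m+n t y) (t+y<s y<r))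

    fR : Fin r → Fin r
    fR j = fromℕ< (fR-bound (toℕ j) (toℕ<n j))

    toℕ-fR : ∀ j → toℕ (fR j) ≡ g (t + toℕ j) ∸ t
    toℕ-fR j = toℕ-fromℕ< (fR-bound (toℕ j) (toℕ<n j))

    fR-injective : Injective _≡_ _≡_ fR
    fR-injective {i} {j} e = toℕ-injective (+-cancelˡ-≡ t _ _ (funℕ-injective τ (t+y<s (toℕ<n i)) (t+y<s (toℕ<n j))
      (∸-cancelʳ-≡ (right-closed _ (m≤m+n t _) (t+y<s (toℕ<n i))) (right-closed _ (m≤m+n t _) (t+y<s (toℕ<n j)))
                   (trans (sym (toℕ-fR i)) (trans (cong toℕ e) (toℕ-fR j))))))

    fR-surjective : Surjective _≡_ _≡_ fR
    fR-surjective y = fromℕ< x∸t<r , λ { refl → toℕ-injective (begin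
        toℕ (fR (fromℕ< x∸t<r))      ≡⟨ toℕ-fR _ ⟩
        g (t + toℕ (fromℕ< x∸t<r)) ∸ t ≡⟨ cong (λ z → g (t + z) ∸ t) (toℕ-fromℕ< x∸t<r) ⟩
        g (t + (x ∸ t)) ∸ t          ≡⟨ cong (λ z → g z ∸ t) (m+[n∸m]≡n t≤x) ⟩
        g x ∸ t                      ≡⟨ cong (_∸ t) gx≡t+y ⟩
        t + toℕ y ∸ t                ≡⟨ m+n∸m≡n t (toℕ y) ⟩
        toℕ y                        ∎) }
      where
      open ≡-Reasoning
      t+y<s′ = t+y<s (toℕ<n y)
      x = preimage (t + toℕ y)
      gx≡t+y : g x ≡ t + toℕ y
      gx≡t+y = g-preimage t+y<s′
      t≤x : t ≤ x
      t≤x with t ≤? x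
      ... | yes t≤x = t≤x
      ... | no  t≰x = contradiction (subst (t ≤_) (sym gx≡t+y) (m≤m+n t (toℕ y))) (<⇒≱ (left-closed x (≰⇒> t≰x)))
      x∸t<r : x ∸ t < r
      x∸t<r = ∸-monoˡ-< (preimage<s t+y<s′) t≤x

    σR : Perm
    σR = perm r fR (fR-injective , fR-surjective)

    σL⊕σR≡τ : ∀ x → x < s → sumFunℕ (σL ∷ σR ∷ []) x ≡ g x
    σL⊕σR≡τ x x<s with <-≤-connex x t
    ... | inj₁ x<t = begin
      sumFunℕ (σL ∷ σR ∷ []) x    ≡⟨ sumFunℕ-< σL _ x<t ⟩
      funℕ σL x                   ≡⟨ funℕ-< σL x<t ⟩
      toℕ (fL (fromℕ< x<t))       ≡⟨ toℕ-fL (fromℕ< x<t) ⟩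
      g (toℕ (fromℕ< x<t))        ≡⟨ cong g (toℕ-fromℕ< x<t) ⟩
      g x                         ∎
      where open ≡-Reasoning
    ... | inj₂ t≤x = begin
      sumFunℕ (σL ∷ σR ∷ []) x            ≡⟨ sumFunℕ-≥ σL _ t≤x ⟩
      t + sumFunℕ (σR ∷ []) (x ∸ t)       ≡⟨ cong (t +_) (sumFunℕ-< σR [] x∸t<r) ⟩
      t + funℕ σR (x ∸ t)                 ≡⟨ cong (t +_) (funℕ-< σR x∸t<r) ⟩
      t + toℕ (fR (fromℕ< x∸t<r))         ≡⟨ cong (t +_) (toℕ-fR (fromℕ< x∸t<r)) ⟩
      t + (g (t + toℕ (fromℕ< x∸t<r)) ∸ t) ≡⟨ cong (λ z → t + (g (t + z) ∸ t)) (toℕ-fromℕ< x∸t<r) ⟩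
      t + (g (t + (x ∸ t)) ∸ t)           ≡⟨ cong (λ z → t + (g z ∸ t)) (m+[n∸m]≡n t≤x) ⟩
      t + (g x ∸ t)                       ≡⟨ m+[n∸m]≡n (right-closed x t≤x x<s) ⟩
      g x                                 ∎
      where
      open ≡-Reasoning
      x∸t<r : x ∸ t < r
      x∸t<r = ∸-monoˡ-< x<s t≤x

    σL⊕σR-size : sumSize (σL ∷ σR ∷ []) ≡ size τ
    σL⊕σR-size = trans (cong (t +_) (+-identityʳ r)) (m+[n∸m]≡n (<⇒≤ t<s))

  cut⇒decomposable : Decomposable τ
  cut⇒decomposable = σL , σR , 0<t , m<n⇒0<n∸m t<s , σL⊕σR-size , λ i → begin
    toℕ (fun τ i)                                   ≡⟨ funℕ-toℕ τ i ⟨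
    g (toℕ i)                                       ≡⟨ σL⊕σR≡τ (toℕ i) (toℕ<n i) ⟨
    sumFunℕ (σL ∷ σR ∷ []) (toℕ i)                  ≡⟨ cong (sumFunℕ (σL ∷ σR ∷ [])) (toℕ-cast (sym σL⊕σR-size) i) ⟨
    sumFunℕ (σL ∷ σR ∷ []) (toℕ (cast _ i))         ≡⟨ toℕ-sumFun (σL ∷ σR ∷ []) _ ⟨
    toℕ (sumFun (σL ∷ σR ∷ []) (cast _ i))          ∎
    where open ≡-Reasoning

sumSize≡sum : ∀ ps → sumSize ps ≡ sum (map size ps)
sumSize≡sum []       = refl
sumSize≡sum (p ∷ ps) = cong (size p +_) (sumSize≡sum ps)

letterOf : List Perm → ℕ → ℕ
letterOf ps = blockOf (map size ps)

Cut-cong : ∀ {f g S t} → (∀ x → x < S → f x ≡ g x) → Cut f S t → Cut g S t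
Cut-cong f≗g cut a b a<t t≤b b<S =
  subst₂ _<_ (f≗g a (<-≤-trans a<t (≤-trans t≤b (<⇒≤ b<S)))) (f≗g b b<S) (cut a b a<t t≤b b<S)

Cut-head : ∀ p w → Cut (sumFunℕ (p ∷ w)) (size p + sumSize w) (size p)
Cut-head p w a b a<n n≤b _ rewrite sumFunℕ-< p w a<n | sumFunℕ-≥ p w n≤b =
  <-≤-trans (funℕ<size p a<n) (m≤m+n (size p) _)

Cut-restrict : ∀ p w {S t} → Cut (sumFunℕ (p ∷ w)) S t → t ≤ size p → size p ≤ S → Cut (funℕ p) (size p) t
Cut-restrict p w cut t≤n n≤S a b a<t t≤b b<n =
  subst₂ _<_ (sumFunℕ-< p w (<-≤-trans a<t t≤n)) (sumFunℕ-< p w b<n) (cut a b a<t t≤b (<-≤-trans b<n n≤S))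

Cut-tail : ∀ p w {S t} → Cut (sumFunℕ (p ∷ w)) (size p + S) (size p + t) → Cut (sumFunℕ w) S t
Cut-tail p w cut a b a<t t≤b b<S = +-cancelˡ-< (size p) _ _ (subst₂ _<_ (sumFunℕ-+ p w a) (sumFunℕ-+ p w b)
  (cut (size p + a) (size p + b) (+-monoʳ-< (size p) a<t) (+-monoʳ-≤ (size p) t≤b) (+-monoʳ-< (size p) b<S)))

-- A cut inside a letter would decompose it.
Cut⇒letter-boundary : ∀ w → All Indecomposable w → ∀ a → suc a < sumSize w →
                      Cut (sumFunℕ w) (sumSize w) (suc a) → letterOf w a ≢ letterOf w (suc a)
Cut⇒letter-boundary (p ∷ w) (p-ind ∷ w-ind) a 1+a<Σ cut with <-≤-connex (suc a) (size p) | <-≤-connex a (size p)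
... | inj₁ 1+a<n | _ =
  contradiction (cut⇒decomposable p (suc a) z<s 1+a<n (Cut-restrict p w cut (<⇒≤ 1+a<n) (m≤m+n (size p) _))) (proj₂ p-ind)
... | inj₂ n≤1+a | inj₁ a<n rewrite blockOf-< (size p) (map size w) a<n | blockOf-≥ (size p) (map size w) n≤1+a = 0≢1+n
... | inj₂ _    | inj₂ n≤a = λ e → Cut⇒letter-boundary w w-ind a′ 1+a′<Σ (Cut-tail p w cut′) (suc-injective (begin
    suc (letterOf w a′)            ≡⟨ blockOf-+ (size p) (map size w) a′ ⟨
    letterOf (p ∷ w) (size p + a′) ≡⟨ cong (letterOf (p ∷ w)) n+a′≡a ⟩
    letterOf (p ∷ w) a             ≡⟨ e ⟩
    letterOf (p ∷ w) (suc a)       ≡⟨ cong (letterOf (p ∷ w)) n+1+a′≡1+a ⟨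
    letterOf (p ∷ w) (size p + suc a′) ≡⟨ blockOf-+ (size p) (map size w) (suc a′) ⟩
    suc (letterOf w (suc a′))      ∎))
  where
  open ≡-Reasoning
  a′ = a ∸ size p
  n+a′≡a : size p + a′ ≡ a
  n+a′≡a = m+[n∸m]≡n n≤a
  n+1+a′≡1+a : size p + suc a′ ≡ suc a
  n+1+a′≡1+a = trans (+-suc (size p) a′) (cong suc n+a′≡a)
  1+a′<Σ : suc a′ < sumSize w
  1+a′<Σ = +-cancelˡ-< (size p) _ _ (subst (_< size p + sumSize w) (sym n+1+a′≡1+a) 1+a<Σ)
  cut′ : Cut (sumFunℕ (p ∷ w)) (size p + sumSize w) (size p + suc a′)
  cut′ = subst (Cut (sumFunℕ (p ∷ w)) (size p + sumSize w)) (sym n+1+a′≡1+a) cut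

tabulate-toℕ : ∀ n (g : ℕ → ℕ) → tabulate {n = n} (g ∘ toℕ) ≡ applyUpTo g n
tabulate-toℕ zero    g = refl
tabulate-toℕ (suc n) g = cong (g 0 ∷_) (tabulate-toℕ n (g ∘ suc))

applyUpTo-cong : ∀ n {g h : ℕ → ℕ} → (∀ x → x < n → g x ≡ h x) → applyUpTo g n ≡ applyUpTo h n
applyUpTo-cong zero    _   = refl
applyUpTo-cong (suc n) g≗h = cong₂ _∷_ (g≗h 0 z<s) (applyUpTo-cong n (λ x x<n → g≗h (suc x) (s<s x<n)))

oneLine≡applyUpTo : ∀ p → oneLine p ≡ applyUpTo (funℕ p) (size p)
oneLine≡applyUpTo p = trans (tabulate-cong (sym ∘ funℕ-toℕ p)) (tabulate-toℕ (size p) (funℕ p))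

oneLine-cong : ∀ p q → size p ≡ size q → (∀ x → x < size p → funℕ p x ≡ funℕ q x) → oneLine p ≡ oneLine q
oneLine-cong p q |p|≡|q| p≗q = begin
  oneLine p                          ≡⟨ oneLine≡applyUpTo p ⟩
  applyUpTo (funℕ p) (size p)        ≡⟨ applyUpTo-cong (size p) p≗q ⟩
  applyUpTo (funℕ q) (size p)        ≡⟨ cong (applyUpTo (funℕ q)) |p|≡|q| ⟩
  applyUpTo (funℕ q) (size q)        ≡⟨ oneLine≡applyUpTo q ⟨
  oneLine q                          ∎
  where open ≡-Reasoning

module ℕ-Lex = IsStrictTotalOrder (Lex.<-isStrictTotalOrder {A = ℕ} {_≈_ = _≡_} {_≺_ = _<_} <-isStrictTotalOrder)

≈Σ⇒size≡ : ∀ {p q} → p ≈Σ q → size p ≡ size q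
≈Σ⇒size≡ e = trans (sym (length-tabulate _)) (trans (cong length e) (length-tabulate _))

<Σ-irrefl : ∀ {p q} → p ≈Σ q → ¬ (p <Σ q)
<Σ-irrefl {p} {q} e (inj₁ lt)      = <-irrefl (≈Σ⇒size≡ {p} {q} e) lt
<Σ-irrefl         e (inj₂ (_ , l)) = ℕ-Lex.irrefl (≡⇒Pointwise-≡ e) l

<Σ-trans : ∀ {p q r} → p <Σ q → q <Σ r → p <Σ r
<Σ-trans         (inj₁ a)        (inj₁ b)         = inj₁ (<-trans a b)
<Σ-trans {p}     (inj₁ a)        (inj₂ (e , _))   = inj₁ (subst (size p <_) e a)
<Σ-trans {r = r} (inj₂ (e , _))  (inj₁ b)         = inj₁ (subst (_< size r) (sym e) b)
<Σ-trans         (inj₂ (e₁ , l₁)) (inj₂ (e₂ , l₂)) = inj₂ (trans e₁ e₂ , ℕ-Lex.trans l₁ l₂)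

<Σ-respʳ-≈Σ : ∀ {x y z} → y ≈Σ z → x <Σ y → x <Σ z
<Σ-respʳ-≈Σ {x} {y} {z} e (inj₁ a)       = inj₁ (subst (size x <_) (≈Σ⇒size≡ {y} {z} e) a)
<Σ-respʳ-≈Σ {x} {y} {z} e (inj₂ (s , l)) = inj₂ (trans s (≈Σ⇒size≡ {y} {z} e) , subst (Lex-< _≡_ _<_ (oneLine x)) e l)

<Σ-respˡ-≈Σ : ∀ {x y z} → y ≈Σ z → y <Σ x → z <Σ x
<Σ-respˡ-≈Σ {x} {y} {z} e (inj₁ a)       = inj₁ (subst (_< size x) (≈Σ⇒size≡ {y} {z} e) a)
<Σ-respˡ-≈Σ {x} {y} {z} e (inj₂ (s , l)) =
  inj₂ (trans (sym (≈Σ⇒size≡ {y} {z} e)) s , subst (λ w → Lex-< _≡_ _<_ w (oneLine x)) e l)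

<Σ-compare : ∀ p q → Tri (p <Σ q) (p ≈Σ q) (q <Σ p)
<Σ-compare p q = fromTrichotomy trichotomy
  where
  irr : ∀ {a b} → a ≈Σ b → ¬ (a <Σ b)
  irr {a} {b} = <Σ-irrefl {a} {b}
  asym : ∀ {a b} → a <Σ b → ¬ (b <Σ a)
  asym {a} {b} a<b b<a = irr {a} {a} refl (<Σ-trans {a} {b} {a} a<b b<a)
  trichotomy : p <Σ q ⊎ p ≈Σ q ⊎ q <Σ p
  trichotomy with <-cmp (size p) (size q)
  ... | tri< a _ _ = inj₁ (inj₁ a)
  ... | tri> _ _ c = inj₂ (inj₂ (inj₁ c))
  ... | tri≈ _ s _ with ℕ-Lex.compare (oneLine p) (oneLine q)
  ...   | tri< l _ _ = inj₁ (inj₂ (s , l))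
  ...   | tri≈ _ e _ = inj₂ (inj₁ (Pointwise-≡⇒≡ e))
  ...   | tri> _ _ l = inj₂ (inj₂ (inj₂ (sym s , l)))
  fromTrichotomy : p <Σ q ⊎ p ≈Σ q ⊎ q <Σ p → Tri (p <Σ q) (p ≈Σ q) (q <Σ p)
  fromTrichotomy (inj₁ a)        = tri< a (λ e → irr {p} {q} e a) (asym {p} {q} a)
  fromTrichotomy (inj₂ (inj₁ e)) = tri≈ (irr {p} {q} e) e (irr {q} {p} (sym e))
  fromTrichotomy (inj₂ (inj₂ c)) = tri> (asym {q} {p} c) (λ e → irr {q} {p} (sym e) c) c

<Σ-isStrictTotalOrder : IsStrictTotalOrder _≈Σ_ _<Σ_
<Σ-isStrictTotalOrder = record
  { isStrictPartialOrder = record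
    { isEquivalence = record { refl = refl ; sym = sym ; trans = trans }
    ; irrefl        = λ {p} {q} → <Σ-irrefl {p} {q}
    ; trans         = λ {p} {q} {r} → <Σ-trans {p} {q} {r}
    ; <-resp-≈      = (λ {x} {y} {z} → <Σ-respʳ-≈Σ {x} {y} {z}) , (λ {x} {y} {z} → <Σ-respˡ-≈Σ {x} {y} {z})
    }
  ; compare = <Σ-compare
  }

open Words <Σ-isStrictTotalOrder

-- The first letters have equal size, since otherwise the shorter one cuts the longer.
indecomposable-sum-unique : ∀ w w′ → All Indecomposable w → All Indecomposable w′ → sumSize w ≡ sumSize w′ →
                            (∀ x → x < sumSize w → sumFunℕ w x ≡ sumFunℕ w′ x) → w ≋ w′
indecomposable-sum-unique []      []        _ _ _ _ = []
indecomposable-sum-unique []      (p′ ∷ w′) _ (p′-ind ∷ _) Σ≡ _ =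
  contradiction Σ≡ (<⇒≢ (<-≤-trans (proj₁ p′-ind) (m≤m+n (size p′) _)))
indecomposable-sum-unique (p ∷ w) []        (p-ind ∷ _) _ Σ≡ _ =
  contradiction (sym Σ≡) (<⇒≢ (<-≤-trans (proj₁ p-ind) (m≤m+n (size p) _)))
indecomposable-sum-unique (p ∷ w) (p′ ∷ w′) (p-ind ∷ w-ind) (p′-ind ∷ w′-ind) Σ≡ w≗w′ =
  p≈p′ ∷ indecomposable-sum-unique w w′ w-ind w′-ind (+-cancelˡ-≡ n _ _ (trans Σ≡ (cong (_+ sumSize w′) (sym n≡n′)))) tails≗
  where
  n  = size p
  n′ = size p′
  w′≗w : ∀ x → x < n′ + sumSize w′ → sumFunℕ (p′ ∷ w′) x ≡ sumFunℕ (p ∷ w) x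
  w′≗w x x<Σ′ = sym (w≗w′ x (subst (x <_) (sym Σ≡) x<Σ′))
  n≡n′ : n ≡ n′
  n≡n′ with <-cmp n n′
  ... | tri≈ _ e _ = e
  ... | tri< n<n′ _ _ = contradiction (cut⇒decomposable p′ n (proj₁ p-ind) n<n′
          (Cut-restrict p′ w′ (subst (λ S → Cut (sumFunℕ (p′ ∷ w′)) S n) Σ≡ (Cut-cong w≗w′ (Cut-head p w)))
                        (<⇒≤ n<n′) (m≤m+n n′ _)))
          (proj₂ p′-ind)
  ... | tri> _ _ n′<n = contradiction (cut⇒decomposable p n′ (proj₁ p′-ind) n′<n
          (Cut-restrict p w (subst (λ S → Cut (sumFunℕ (p ∷ w)) S n′) (sym Σ≡) (Cut-cong w′≗w (Cut-head p′ w′)))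
                        (<⇒≤ n′<n) (m≤m+n n _)))
          (proj₂ p-ind)
  p≈p′ : p ≈Σ p′
  p≈p′ = oneLine-cong p p′ n≡n′ λ x x<n → begin
    funℕ p x                 ≡⟨ sumFunℕ-< p w x<n ⟨
    sumFunℕ (p ∷ w) x        ≡⟨ w≗w′ x (<-≤-trans x<n (m≤m+n n _)) ⟩
    sumFunℕ (p′ ∷ w′) x      ≡⟨ sumFunℕ-< p′ w′ (subst (x <_) n≡n′ x<n) ⟩
    funℕ p′ x                ∎
    where open ≡-Reasoning
  tails≗ : ∀ y → y < sumSize w → sumFunℕ w y ≡ sumFunℕ w′ y
  tails≗ y y<Σ = +-cancelˡ-≡ n _ _ (begin
    n + sumFunℕ w y              ≡⟨ sumFunℕ-+ p w y ⟨
    sumFunℕ (p ∷ w) (n + y)      ≡⟨ w≗w′ (n + y) (+-monoʳ-< n y<Σ) ⟩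
    sumFunℕ (p′ ∷ w′) (n + y)    ≡⟨ cong (λ z → sumFunℕ (p′ ∷ w′) (z + y)) n≡n′ ⟩
    sumFunℕ (p′ ∷ w′) (n′ + y)   ≡⟨ sumFunℕ-+ p′ w′ y ⟩
    n′ + sumFunℕ w′ y            ≡⟨ cong (_+ sumFunℕ w′ y) n≡n′ ⟨
    n + sumFunℕ w′ y             ∎)
    where open ≡-Reasoning

SumOfℕ : Perm → List Perm → Set
SumOfℕ π w = sumSize w ≡ size π × (∀ x → x < size π → funℕ π x ≡ sumFunℕ w x)

IsSumOf⇒SumOfℕ : ∀ π w → IsSumOf π w → SumOfℕ π w
IsSumOf⇒SumOfℕ π w (Σ≡ , π≗w) = Σ≡ , λ x x<n → begin
  funℕ π x                                   ≡⟨ funℕ-< π x<n ⟩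
  toℕ (fun π (fromℕ< x<n))                   ≡⟨ π≗w (fromℕ< x<n) ⟩
  toℕ (sumFun w (cast (sym Σ≡) (fromℕ< x<n))) ≡⟨ toℕ-sumFun w _ ⟩
  sumFunℕ w (toℕ (cast (sym Σ≡) (fromℕ< x<n))) ≡⟨ cong (sumFunℕ w) (trans (toℕ-cast (sym Σ≡) _) (toℕ-fromℕ< x<n)) ⟩
  sumFunℕ w x                                ∎
  where open ≡-Reasoning

IsBlockWord-unique : ∀ π w w′ → IsBlockWord π w → IsBlockWord π w′ → w ≋ w′
IsBlockWord-unique π w w′ (w-ind , π≡w) (w′-ind , π≡w′) =
  indecomposable-sum-unique w w′ w-ind w′-ind (trans (proj₁ r) (sym (proj₁ r′)))
    (λ x x<Σ → let x<n = subst (x <_) (proj₁ r) x<Σ in trans (sym (proj₂ r x x<n)) (proj₂ r′ x x<n))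
  where
  r  = IsSumOf⇒SumOfℕ π w π≡w
  r′ = IsSumOf⇒SumOfℕ π w′ π≡w′

-- Strictly increasing maps

StrictlyIncreasing : (ℕ → ℕ) → ℕ → Set
StrictlyIncreasing φ s = ∀ a b → a < b → b < s → φ a < φ b

module _ {φ s} (φ-inc : StrictlyIncreasing φ s) where

  StrictlyIncreasing-injective : BoundedInjective φ s
  StrictlyIncreasing-injective a b a<s b<s e with <-cmp a b
  ... | tri< a<b _ _ = contradiction e (<⇒≢ (φ-inc a b a<b b<s))
  ... | tri≈ _ a≡b _ = a≡b
  ... | tri> _ _ b<a = contradiction (sym e) (<⇒≢ (φ-inc b a b<a a<s))

  StrictlyIncreasing-cancel-< : ∀ {a b} → a < s → b < s → φ a < φ b → a < b
  StrictlyIncreasing-cancel-< {a} {b} a<s b<s φa<φb with <-cmp a b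
  ... | tri< a<b _ _  = a<b
  ... | tri≈ _ refl _ = contradiction φa<φb (<-irrefl refl)
  ... | tri> _ _ b<a  = contradiction φa<φb (<-asym (φ-inc b a b<a a<s))

  StrictlyIncreasing-mono-≤ : ∀ {a b} → a ≤ b → b < s → φ a ≤ φ b
  StrictlyIncreasing-mono-≤ {a} {b} a≤b b<s with m≤n⇒m<n∨m≡n a≤b
  ... | inj₁ a<b  = <⇒≤ (φ-inc a b a<b b<s)
  ... | inj₂ refl = ≤-refl

  StrictlyIncreasing-+ : ∀ a j → a + j < s → φ a + j ≤ φ (a + j)
  StrictlyIncreasing-+ a zero    _     = ≤-reflexive (trans (+-identityʳ (φ a)) (cong φ (sym (+-identityʳ a))))
  StrictlyIncreasing-+ a (suc j) a+j<s = begin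
    φ a + suc j        ≡⟨ +-suc (φ a) j ⟩
    suc (φ a + j)      ≤⟨ s≤s (StrictlyIncreasing-+ a j (<-trans step a+j<s)) ⟩
    suc (φ (a + j))    ≤⟨ φ-inc (a + j) (a + suc j) step a+j<s ⟩
    φ (a + suc j)      ∎
    where
    open ≤-Reasoning
    step : a + j < a + suc j
    step = +-monoʳ-< a (n<1+n j)

  StrictlyIncreasing⇒≤ : ∀ {S} → (∀ a → a < s → φ a < S) → s ≤ S
  StrictlyIncreasing⇒≤ φ<S = bounded-injection⇒≤ φ φ<S StrictlyIncreasing-injective

  -- φ a ≥ a, and φ a ≤ a since the s ∸ 1 ∸ a values above a must still fit below s.
  StrictlyIncreasing-endo⇒id : (∀ a → a < s → φ a < s) → ∀ a → a < s → φ a ≡ a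
  StrictlyIncreasing-endo⇒id φ<s a a<s = ≤-antisym φa≤a a≤φa
    where
    a≤φa : a ≤ φ a
    a≤φa = ≤-trans (m≤n+m a (φ 0)) (StrictlyIncreasing-+ 0 a a<s)
    j = s ∸ suc a
    a+j<s : a + j < s
    a+j<s = ≤-reflexive (m+[n∸m]≡n a<s)
    φa≤a : φ a ≤ a
    φa≤a = ≤-pred (+-cancelʳ-< j (φ a) (suc a)
             (subst (φ a + j <_) (sym (m+[n∸m]≡n a<s))
                    (≤-<-trans (StrictlyIncreasing-+ a j a+j<s) (φ<s (a + j) a+j<s))))

increasing-enumerations-agree : ∀ {k e : ℕ → ℕ} {s S : ℕ} → StrictlyIncreasing k s → StrictlyIncreasing e S →
  (∀ a → a < s → ∃ λ b → b < S × e b ≡ k a) →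
  (∀ b → b < S → ∃ λ a → a < s × k a ≡ e b) →
  s ≡ S × (∀ a → a < s → k a ≡ e a)
increasing-enumerations-agree {k} {e} {s} {S} k-inc e-inc k⊆e e⊆k =
  s≡S , λ a a<s → trans (sym (proj₂ (φ-spec a a<s)))
                        (cong e (StrictlyIncreasing-endo⇒id φ-inc (λ a a<s → subst (φ a <_) (sym s≡S) (proj₁ (φ-spec a a<s))) a a<s))
  where
  φ = choose k⊆e
  φ-spec = choose-spec k⊆e
  ψ = choose e⊆k
  ψ-spec = choose-spec e⊆k
  φ-inc : StrictlyIncreasing φ s
  φ-inc a b a<b b<s = StrictlyIncreasing-cancel-< e-inc (proj₁ (φ-spec a (<-trans a<b b<s))) (proj₁ (φ-spec b b<s))
    (subst₂ _<_ (sym (proj₂ (φ-spec a (<-trans a<b b<s)))) (sym (proj₂ (φ-spec b b<s))) (k-inc a b a<b b<s))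
  ψ-inc : StrictlyIncreasing ψ S
  ψ-inc a b a<b b<S = StrictlyIncreasing-cancel-< k-inc (proj₁ (ψ-spec a (<-trans a<b b<S))) (proj₁ (ψ-spec b b<S))
    (subst₂ _<_ (sym (proj₂ (ψ-spec a (<-trans a<b b<S)))) (sym (proj₂ (ψ-spec b b<S))) (e-inc a b a<b b<S))
  s≡S : s ≡ S
  s≡S = ≤-antisym (StrictlyIncreasing⇒≤ φ-inc (λ a a<s → proj₁ (φ-spec a a<s)))
                  (StrictlyIncreasing⇒≤ ψ-inc (λ a a<S → proj₁ (ψ-spec a a<S)))

-- h ∘ g⁻¹ is strictly increasing on [0, s), hence the identity.
order-isomorphic⇒≡ : ∀ {g h : ℕ → ℕ} {s : ℕ} → (∀ x → x < s → g x < s) →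
  (∀ y → y < s → ∃ λ x → x < s × g x ≡ y) → (∀ x → x < s → h x < s) →
  (∀ a b → a < s → b < s → g a < g b → h a < h b) →
  (∀ a b → a < s → b < s → h a < h b → g a < g b) →
  ∀ a → a < s → g a ≡ h a
order-isomorphic⇒≡ {g} {h} {s} g<s g-onto h<s g⇒h h⇒g a a<s = trans (sym (h∘g⁻¹≡id (g a) (g<s a a<s))) (sym ha≡ha′)
  where
  g⁻¹ = choose g-onto
  g⁻¹-spec = choose-spec g-onto
  h∘g⁻¹-inc : StrictlyIncreasing (h ∘ g⁻¹) s
  h∘g⁻¹-inc y y′ y<y′ y′<s = g⇒h _ _ (proj₁ (g⁻¹-spec y (<-trans y<y′ y′<s))) (proj₁ (g⁻¹-spec y′ y′<s))
    (subst₂ _<_ (sym (proj₂ (g⁻¹-spec y (<-trans y<y′ y′<s)))) (sym (proj₂ (g⁻¹-spec y′ y′<s))) y<y′)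
  h∘g⁻¹≡id : ∀ y → y < s → h (g⁻¹ y) ≡ y
  h∘g⁻¹≡id = StrictlyIncreasing-endo⇒id h∘g⁻¹-inc (λ y y<s → h<s (g⁻¹ y) (proj₁ (g⁻¹-spec y y<s)))
  a′ = g⁻¹ (g a)
  a′<s = proj₁ (g⁻¹-spec (g a) (g<s a a<s))
  ga′≡ga : g a′ ≡ g a
  ga′≡ga = proj₂ (g⁻¹-spec (g a) (g<s a a<s))
  ha≡ha′ : h a ≡ h a′
  ha≡ha′ with <-cmp (h a) (h a′)
  ... | tri≈ _ e _ = e
  ... | tri< lt _ _ = contradiction (h⇒g a a′ a<s a′<s lt) (<-irrefl (sym ga′≡ga))
  ... | tri> _ _ gt = contradiction (h⇒g a′ a a′<s a<s gt) (<-irrefl ga′≡ga)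

-- Subwords of labelled sums

<⊎≡+ : ∀ n a → a < n ⊎ ∃ λ y → a ≡ n + y
<⊎≡+ n a with <-≤-connex a n
... | inj₁ a<n = inj₁ a<n
... | inj₂ n≤a = inj₂ (a ∸ n , sym (m+[n∸m]≡n n≤a))

shiftAbove : ℕ → (ℕ → ℕ) → ℕ → ℕ
shiftAbove n f a with a <? n
... | yes _ = a
... | no  _ = n + f (a ∸ n)

shiftAbove-< : ∀ n f {a} → a < n → shiftAbove n f a ≡ a
shiftAbove-< n f {a} a<n with a <? n
... | yes _   = refl
... | no  a≮n = contradiction a<n a≮n

shiftAbove-+ : ∀ n f y → shiftAbove n f (n + y) ≡ n + f y
shiftAbove-+ n f y with n + y <? n
... | yes n+y<n = contradiction n+y<n (m+n≮m n y)
... | no  _     = cong ((n +_) ∘ f) (m+n∸m≡n n y)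

shiftAbove-increasing : ∀ n f S → StrictlyIncreasing f S → StrictlyIncreasing (shiftAbove n f) (n + S)
shiftAbove-increasing n f S f-inc a b a<b b<n+S with <⊎≡+ n a | <⊎≡+ n b
... | inj₁ a<n        | inj₁ b<n        rewrite shiftAbove-< n f a<n | shiftAbove-< n f b<n = a<b
... | inj₁ a<n        | inj₂ (y , refl) rewrite shiftAbove-< n f a<n | shiftAbove-+ n f y = <-≤-trans a<n (m≤m+n n (f y))
... | inj₂ (x , refl) | inj₁ b<n        = contradiction (<-trans a<b b<n) (m+n≮m n x)
... | inj₂ (x , refl) | inj₂ (y , refl) rewrite shiftAbove-+ n f x | shiftAbove-+ n f y =
  +-monoʳ-< n (f-inc x y (+-cancelˡ-< n x y a<b) (+-cancelˡ-< n y S b<n+S))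

<-transfer-shared-head : ∀ n (h F G F′ G′ : ℕ → ℕ) S →
  (∀ a → a < n → F a ≡ h a) → (∀ a → a < n → G a ≡ h a) → (∀ a → a < n → h a < n) →
  (∀ y → F (n + y) ≡ n + F′ y) → (∀ y → G (n + y) ≡ n + G′ y) →
  (∀ a b → a < S → b < S → F′ a < F′ b → G′ a < G′ b) →
  ∀ a b → a < n + S → b < n + S → F a < F b → G a < G b
<-transfer-shared-head n h F G F′ G′ S F≗h G≗h h<n F+ G+ F′⇒G′ a b a<n+S b<n+S Fa<Fb with <⊎≡+ n a | <⊎≡+ n b
... | inj₁ a<n        | inj₁ b<n        = subst₂ _<_ (sym (G≗h a a<n)) (sym (G≗h b b<n)) (subst₂ _<_ (F≗h a a<n) (F≗h b b<n) Fa<Fb)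
... | inj₁ a<n        | inj₂ (y , refl) = subst₂ _<_ (sym (G≗h a a<n)) (sym (G+ y)) (<-≤-trans (h<n a a<n) (m≤m+n n (G′ y)))
... | inj₂ (x , refl) | inj₁ b<n        = contradiction (<-trans (subst₂ _<_ (F+ x) (F≗h b b<n) Fa<Fb) (h<n b b<n)) (m+n≮m n (F′ x))
... | inj₂ (x , refl) | inj₂ (y , refl) = subst₂ _<_ (sym (G+ x)) (sym (G+ y))
  (+-monoʳ-< n (F′⇒G′ x y (+-cancelˡ-< n x S a<n+S) (+-cancelˡ-< n y S b<n+S) (+-cancelˡ-< n _ _ (subst₂ _<_ (F+ x) (F+ y) Fa<Fb))))

labelAt : Labelled → ℕ → ℕ
labelAt []             x = 0
labelAt ((p , l) ∷ zs) x with x <? size p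
... | yes _ = l
... | no  _ = labelAt zs (x ∸ size p)

labelAt-< : ∀ p l zs {x} → x < size p → labelAt ((p , l) ∷ zs) x ≡ l
labelAt-< p l zs {x} x<n with x <? size p
... | yes _   = refl
... | no  x≮n = contradiction x<n x≮n

labelAt-≥ : ∀ p l zs {x} → size p ≤ x → labelAt ((p , l) ∷ zs) x ≡ labelAt zs (x ∸ size p)
labelAt-≥ p l zs {x} n≤x with x <? size p
... | yes x<n = contradiction n≤x (<⇒≱ x<n)
... | no  _   = refl

labelAt-+ : ∀ p l zs y → labelAt ((p , l) ∷ zs) (size p + y) ≡ labelAt zs y
labelAt-+ p l zs y = trans (labelAt-≥ p l zs (m≤m+n (size p) y)) (cong (labelAt zs) (m+n∸m≡n (size p) y))

-- Position a of the sum of subword c zs sits at position embed c zs a of the sum of letters zs.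
embed : ℕ → Labelled → ℕ → ℕ
embed c []             = id
embed c ((p , l) ∷ zs) with l ≟ c
... | yes _ = shiftAbove (size p) (embed c zs)
... | no  _ = (size p +_) ∘ embed c zs

module _ (c : ℕ) where

  embed-increasing : ∀ zs → StrictlyIncreasing (embed c zs) (sumSize (subword c zs))
  embed-increasing ((p , l) ∷ zs) with l ≟ c
  ... | yes _ = shiftAbove-increasing (size p) (embed c zs) _ (embed-increasing zs)
  ... | no  _ = λ a b a<b b<S → +-monoʳ-< (size p) (embed-increasing zs a b a<b b<S)

  embed<sumSize : ∀ zs a → a < sumSize (subword c zs) → embed c zs a < sumSize (letters zs)
  embed<sumSize ((p , l) ∷ zs) a a<S with l ≟ c
  ... | no  _ = +-monoʳ-< (size p) (embed<sumSize zs a a<S)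
  ... | yes _ with <⊎≡+ (size p) a
  ...   | inj₁ a<n        rewrite shiftAbove-< (size p) (embed c zs) a<n = <-≤-trans a<n (m≤m+n _ _)
  ...   | inj₂ (y , refl) rewrite shiftAbove-+ (size p) (embed c zs) y =
    +-monoʳ-< (size p) (embed<sumSize zs y (+-cancelˡ-< (size p) _ _ a<S))

  labelAt-embed : ∀ zs a → a < sumSize (subword c zs) → labelAt zs (embed c zs a) ≡ c
  labelAt-embed ((p , l) ∷ zs) a a<S with l ≟ c
  ... | no  _ = trans (labelAt-+ p l zs _) (labelAt-embed zs a a<S)
  ... | yes refl with <⊎≡+ (size p) a
  ...   | inj₁ a<n        rewrite shiftAbove-< (size p) (embed l zs) a<n = labelAt-< p l zs a<n
  ...   | inj₂ (y , refl) rewrite shiftAbove-+ (size p) (embed l zs) y =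
    trans (labelAt-+ p l zs _) (labelAt-embed zs y (+-cancelˡ-< (size p) _ _ a<S))

  embed-onto : ∀ zs x → x < sumSize (letters zs) → labelAt zs x ≡ c →
               ∃ λ a → a < sumSize (subword c zs) × embed c zs a ≡ x
  embed-onto ((p , l) ∷ zs) x x<Σ x↦c with l ≟ c | <⊎≡+ (size p) x
  ... | no l≢c | inj₁ x<n        = contradiction (trans (sym (labelAt-< p l zs x<n)) x↦c) l≢c
  ... | yes _  | inj₁ x<n        = x , <-≤-trans x<n (m≤m+n (size p) _) , shiftAbove-< (size p) (embed c zs) x<n
  ... | yes _  | inj₂ (y , refl) =
    let a , a<S , a↦y = embed-onto zs y (+-cancelˡ-< (size p) _ _ x<Σ) (trans (sym (labelAt-+ p l zs y)) x↦c)
    in size p + a , +-monoʳ-< (size p) a<S , trans (shiftAbove-+ (size p) (embed c zs) a) (cong (size p +_) a↦y)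
  ... | no _   | inj₂ (y , refl) =
    let a , a<S , a↦y = embed-onto zs y (+-cancelˡ-< (size p) _ _ x<Σ) (trans (sym (labelAt-+ p l zs y)) x↦c)
    in a , a<S , cong (size p +_) a↦y

  embed-order : ∀ zs a b → a < sumSize (subword c zs) → b < sumSize (subword c zs) →
    (sumFunℕ (letters zs) (embed c zs a) < sumFunℕ (letters zs) (embed c zs b)) ⇔
    (sumFunℕ (subword c zs) a < sumFunℕ (subword c zs) b)
  embed-order ((p , l) ∷ zs) a b a<S b<S with l ≟ c
  ... | no _ = mk⇔
    (λ lt → Equivalence.to (embed-order zs a b a<S b<S)
              (+-cancelˡ-< (size p) _ _ (subst₂ _<_ (sumFunℕ-+ p (letters zs) _) (sumFunℕ-+ p (letters zs) _) lt)))
    (λ lt → subst₂ _<_ (sym (sumFunℕ-+ p (letters zs) _)) (sym (sumFunℕ-+ p (letters zs) _))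
              (+-monoʳ-< (size p) (Equivalence.from (embed-order zs a b a<S b<S) lt)))
  ... | yes _ = mk⇔
    (<-transfer-shared-head n (funℕ p) F G F′ G′ S F≗p G≗p (λ _ → funℕ<size p) F+ G+
       (λ a b a<S b<S → Equivalence.to (embed-order zs a b a<S b<S)) a b a<S b<S)
    (<-transfer-shared-head n (funℕ p) G F G′ F′ S G≗p F≗p (λ _ → funℕ<size p) G+ F+
       (λ a b a<S b<S → Equivalence.from (embed-order zs a b a<S b<S)) a b a<S b<S)
    where
    n = size p
    S = sumSize (subword c zs)
    F = sumFunℕ (p ∷ letters zs) ∘ shiftAbove n (embed c zs)
    G = sumFunℕ (p ∷ subword c zs)
    F′ = sumFunℕ (letters zs) ∘ embed c zs
    G′ = sumFunℕ (subword c zs)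
    F≗p : ∀ a → a < n → F a ≡ funℕ p a
    F≗p a a<n = trans (cong (sumFunℕ (p ∷ letters zs)) (shiftAbove-< n (embed c zs) a<n)) (sumFunℕ-< p (letters zs) a<n)
    G≗p : ∀ a → a < n → G a ≡ funℕ p a
    G≗p a a<n = sumFunℕ-< p (subword c zs) a<n
    F+ : ∀ y → F (n + y) ≡ n + F′ y
    F+ y = trans (cong (sumFunℕ (p ∷ letters zs)) (shiftAbove-+ n (embed c zs) y)) (sumFunℕ-+ p (letters zs) _)
    G+ : ∀ y → G (n + y) ≡ n + G′ y
    G+ y = sumFunℕ-+ p (subword c zs) y

sumSize-++ : ∀ u v → sumSize (u ++ v) ≡ sumSize u + sumSize v
sumSize-++ []      v = refl
sumSize-++ (p ∷ u) v = trans (cong (size p +_) (sumSize-++ u v)) (sym (+-assoc (size p) _ _))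

sumSize-concat : ∀ ws → sumSize (concat ws) ≡ sum (map sumSize ws)
sumSize-concat []       = refl
sumSize-concat (w ∷ ws) = trans (sumSize-++ w (concat ws)) (cong (sumSize w +_) (sumSize-concat ws))

letterOf-++ˡ : ∀ u v {x} → x < sumSize u → letterOf (u ++ v) x ≡ letterOf u x
letterOf-++ˡ (p ∷ u) v {x} x<Σ with <-≤-connex x (size p)
... | inj₁ x<n rewrite blockOf-< (size p) (map size (u ++ v)) x<n | blockOf-< (size p) (map size u) x<n = refl
... | inj₂ n≤x rewrite blockOf-≥ (size p) (map size (u ++ v)) n≤x | blockOf-≥ (size p) (map size u) n≤x =
  cong suc (letterOf-++ˡ u v (∸-<-+ n≤x x<Σ))

letterOf-++ʳ : ∀ u v y → letterOf (u ++ v) (sumSize u + y) ≡ length u + letterOf v y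
letterOf-++ʳ []      v y = refl
letterOf-++ʳ (p ∷ u) v y = trans (cong (letterOf (p ∷ u ++ v)) (+-assoc (size p) (sumSize u) y))
                                 (trans (blockOf-+ (size p) (map size (u ++ v)) _) (cong suc (letterOf-++ʳ u v y)))

sumFunℕ-++ˡ : ∀ u v {x} → x < sumSize u → sumFunℕ (u ++ v) x ≡ sumFunℕ u x
sumFunℕ-++ˡ (p ∷ u) v {x} x<Σ with <-≤-connex x (size p)
... | inj₁ x<n = trans (sumFunℕ-< p (u ++ v) x<n) (sym (sumFunℕ-< p u x<n))
... | inj₂ n≤x = trans (sumFunℕ-≥ p (u ++ v) n≤x)
                       (trans (cong (size p +_) (sumFunℕ-++ˡ u v (∸-<-+ n≤x x<Σ))) (sym (sumFunℕ-≥ p u n≤x)))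

sumFunℕ-++ʳ : ∀ u v y → sumFunℕ (u ++ v) (sumSize u + y) ≡ sumSize u + sumFunℕ v y
sumFunℕ-++ʳ []      v y = refl
sumFunℕ-++ʳ (p ∷ u) v y = begin
  sumFunℕ (p ∷ u ++ v) (size p + sumSize u + y)   ≡⟨ cong (sumFunℕ (p ∷ u ++ v)) (+-assoc (size p) (sumSize u) y) ⟩
  sumFunℕ (p ∷ u ++ v) (size p + (sumSize u + y)) ≡⟨ sumFunℕ-+ p (u ++ v) _ ⟩
  size p + sumFunℕ (u ++ v) (sumSize u + y)       ≡⟨ cong (size p +_) (sumFunℕ-++ʳ u v y) ⟩
  size p + (sumSize u + sumFunℕ v y)              ≡⟨ +-assoc (size p) _ _ ⟨
  size p + sumSize u + sumFunℕ v y                ∎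
  where open ≡-Reasoning

letterOf-<⇒sumFunℕ-< : ∀ L u v → v < sumSize L → letterOf L u < letterOf L v → sumFunℕ L u < sumFunℕ L v
letterOf-<⇒sumFunℕ-< (p ∷ L) u v v<Σ lt with <-≤-connex u (size p) | <-≤-connex v (size p)
... | _        | inj₁ v<n rewrite blockOf-< (size p) (map size L) v<n = contradiction lt n≮0
... | inj₁ u<n | inj₂ n≤v rewrite sumFunℕ-< p L u<n | sumFunℕ-≥ p L n≤v = <-≤-trans (funℕ<size p u<n) (m≤m+n (size p) _)
... | inj₂ n≤u | inj₂ n≤v rewrite sumFunℕ-≥ p L n≤u | sumFunℕ-≥ p L n≤v
                                | blockOf-≥ (size p) (map size L) n≤u | blockOf-≥ (size p) (map size L) n≤v =
  +-monoʳ-< (size p) (letterOf-<⇒sumFunℕ-< L (u ∸ size p) (v ∸ size p) (∸-<-+ n≤v v<Σ) (≤-pred lt))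

at-map-sumSize : ∀ ws i → at (map sumSize ws) i ≡ sumSize (nth ws i)
at-map-sumSize []       i       = refl
at-map-sumSize (w ∷ ws) zero    = refl
at-map-sumSize (w ∷ ws) (suc i) = at-map-sumSize ws i

at-map-length : ∀ ws i → at (map length ws) i ≡ length (nth ws i)
at-map-length []       i       = refl
at-map-length (w ∷ ws) zero    = refl
at-map-length (w ∷ ws) (suc i) = at-map-length ws i

letterOf-concat : ∀ ws i a → i < length ws → a < sumSize (nth ws i) →
  letterOf (concat ws) (offset (map sumSize ws) i + a) ≡ offset (map length ws) i + letterOf (nth ws i) a
letterOf-concat (w ∷ ws) zero    a _         a<Σ = letterOf-++ˡ w (concat ws) a<Σ
letterOf-concat (w ∷ ws) (suc i) a (s≤s i<n) a<Σ = begin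
  letterOf (w ++ concat ws) (sumSize w + offset (map sumSize ws) i + a)   ≡⟨ cong (letterOf (w ++ concat ws)) (+-assoc (sumSize w) _ a) ⟩
  letterOf (w ++ concat ws) (sumSize w + (offset (map sumSize ws) i + a)) ≡⟨ letterOf-++ʳ w (concat ws) _ ⟩
  length w + letterOf (concat ws) (offset (map sumSize ws) i + a)         ≡⟨ cong (length w +_) (letterOf-concat ws i a i<n a<Σ) ⟩
  length w + (offset (map length ws) i + letterOf (nth ws i) a)           ≡⟨ +-assoc (length w) _ _ ⟨
  length w + offset (map length ws) i + letterOf (nth ws i) a             ∎
  where open ≡-Reasoning

sumFunℕ-concat : ∀ πs ws → Pointwise SumOfℕ πs ws → ∀ x → x < sumSize πs → sumFunℕ πs x ≡ sumFunℕ (concat ws) x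
sumFunℕ-concat (π ∷ πs) (w ∷ ws) ((Σ≡ , π≗w) ∷ rest) x x<Σ with <-≤-connex x (size π)
... | inj₁ x<n = begin
  sumFunℕ (π ∷ πs) x           ≡⟨ sumFunℕ-< π πs x<n ⟩
  funℕ π x                     ≡⟨ π≗w x x<n ⟩
  sumFunℕ w x                  ≡⟨ sumFunℕ-++ˡ w (concat ws) (subst (x <_) (sym Σ≡) x<n) ⟨
  sumFunℕ (w ++ concat ws) x   ∎
  where open ≡-Reasoning
... | inj₂ n≤x = begin
  sumFunℕ (π ∷ πs) x                                        ≡⟨ sumFunℕ-≥ π πs n≤x ⟩
  size π + sumFunℕ πs (x ∸ size π)                          ≡⟨ cong (size π +_) (sumFunℕ-concat πs ws rest _ (∸-<-+ n≤x x<Σ)) ⟩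
  size π + sumFunℕ (concat ws) (x ∸ size π)                 ≡⟨ cong (_+ sumFunℕ (concat ws) (x ∸ size π)) Σ≡ ⟨
  sumSize w + sumFunℕ (concat ws) (x ∸ size π)              ≡⟨ sumFunℕ-++ʳ w (concat ws) (x ∸ size π) ⟨
  sumFunℕ (w ++ concat ws) (sumSize w + (x ∸ size π))       ≡⟨ cong (λ z → sumFunℕ (w ++ concat ws) (z + (x ∸ size π))) Σ≡ ⟩
  sumFunℕ (w ++ concat ws) (size π + (x ∸ size π))          ≡⟨ cong (sumFunℕ (w ++ concat ws)) (m+[n∸m]≡n n≤x) ⟩
  sumFunℕ (w ++ concat ws) x                                ∎
  where open ≡-Reasoning

SumOfℕ-sizes : ∀ {πs ws} → Pointwise SumOfℕ πs ws → map sumSize ws ≡ map size πs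
SumOfℕ-sizes []               = refl
SumOfℕ-sizes ((Σ≡ , _) ∷ rs) = cong₂ _∷_ Σ≡ (SumOfℕ-sizes rs)

labelByStart : (ℕ → ℕ) → List Perm → ℕ → Labelled
labelByStart class []      o = []
labelByStart class (p ∷ L) o = (p , class o) ∷ labelByStart class L (o + size p)

letters-labelByStart : ∀ class L o → letters (labelByStart class L o) ≡ L
letters-labelByStart class []      o = refl
letters-labelByStart class (p ∷ L) o = cong (p ∷_) (letters-labelByStart class L (o + size p))

labelAt-labelByStart : ∀ class L o x → x < sumSize L →
  labelAt (labelByStart class L o) x ≡ class (o + offset (map size L) (letterOf L x))
labelAt-labelByStart class (p ∷ L) o x x<Σ with <-≤-connex x (size p)
... | inj₁ x<n rewrite labelAt-< p (class o) (labelByStart class L (o + size p)) x<n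
                     | blockOf-< (size p) (map size L) x<n = cong class (sym (+-identityʳ o))
... | inj₂ n≤x rewrite labelAt-≥ p (class o) (labelByStart class L (o + size p)) n≤x
                     | blockOf-≥ (size p) (map size L) n≤x =
  trans (labelAt-labelByStart class L (o + size p) (x ∸ size p) (∸-<-+ n≤x x<Σ)) (cong class (+-assoc o (size p) _))

Occurs-labelByStart : ∀ class L o → All Indecomposable L → ∀ c → Occurs c (labelByStart class L o) →
                      ∃ λ d → d < sumSize L × c ≡ class (o + d)
Occurs-labelByStart class (p ∷ L) o (p-ind ∷ _) c (here refl) =
  0 , <-≤-trans (proj₁ p-ind) (m≤m+n (size p) _) , cong class (sym (+-identityʳ o))
Occurs-labelByStart class (p ∷ L) o (_ ∷ L-ind) c (there c∈) =
  let d , d<Σ , c≡ = Occurs-labelByStart class L (o + size p) L-ind c c∈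
  in size p + d , +-monoʳ-< (size p) d<Σ , trans c≡ (cong class (+-assoc o (size p) d))

labelAt≡at-labels : ∀ zs x → x < sumSize (letters zs) → labelAt zs x ≡ at (labels zs) (letterOf (letters zs) x)
labelAt≡at-labels ((p , l) ∷ zs) x x<Σ with <-≤-connex x (size p)
... | inj₁ x<n rewrite labelAt-< p l zs x<n | blockOf-< (size p) (map size (letters zs)) x<n = refl
... | inj₂ n≤x rewrite labelAt-≥ p l zs n≤x | blockOf-≥ (size p) (map size (letters zs)) n≤x =
  labelAt≡at-labels zs (x ∸ size p) (∸-<-+ n≤x x<Σ)

at-++ˡ : ∀ u v i → i < length u → at (u ++ v) i ≡ at u i
at-++ˡ (a ∷ u) v zero    _         = refl
at-++ˡ (a ∷ u) v (suc i) (s≤s i<n) = at-++ˡ u v i i<n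

at-++ʳ : ∀ u v i → at (u ++ v) (length u + i) ≡ at v i
at-++ʳ []      v i = refl
at-++ʳ (a ∷ u) v i = at-++ʳ u v i

at-replicate : ∀ k b i → i < k → at (replicate k b) i ≡ b
at-replicate (suc k) b zero    _         = refl
at-replicate (suc k) b (suc i) (s≤s i<k) = at-replicate k b i i<k

at-canonicalLabels : ∀ ws b g → g < sum (map length ws) → at (canonicalLabels b ws) g ≡ b + blockOf (map length ws) g
at-canonicalLabels (w ∷ ws) b g g<Σ with <-≤-connex g (length w)
... | inj₁ g<|w| rewrite blockOf-< (length w) (map length ws) g<|w| = begin
  at (replicate (length w) b ++ canonicalLabels (suc b) ws) g
    ≡⟨ at-++ˡ (replicate (length w) b) _ g (subst (g <_) (sym (length-replicate (length w))) g<|w|) ⟩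
  at (replicate (length w) b) g                               ≡⟨ at-replicate (length w) b g g<|w| ⟩
  b                                                           ≡⟨ +-identityʳ b ⟨
  b + 0                                                       ∎
  where open ≡-Reasoning
... | inj₂ |w|≤g rewrite blockOf-≥ (length w) (map length ws) |w|≤g = begin
  at (replicate (length w) b ++ canonicalLabels (suc b) ws) g
    ≡⟨ cong (at (replicate (length w) b ++ canonicalLabels (suc b) ws)) g≡ ⟨
  at (replicate (length w) b ++ canonicalLabels (suc b) ws) (length (replicate (length w) b) + (g ∸ length w))
    ≡⟨ at-++ʳ (replicate (length w) b) _ (g ∸ length w) ⟩
  at (canonicalLabels (suc b) ws) (g ∸ length w)
    ≡⟨ at-canonicalLabels ws (suc b) (g ∸ length w) (∸-<-+ |w|≤g g<Σ) ⟩
  suc b + blockOf (map length ws) (g ∸ length w)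
    ≡⟨ +-suc b _ ⟨
  b + suc (blockOf (map length ws) (g ∸ length w))   ∎
  where
  open ≡-Reasoning
  g≡ : length (replicate (length w) b) + (g ∸ length w) ≡ g
  g≡ = trans (cong (_+ (g ∸ length w)) (length-replicate (length w))) (m+[n∸m]≡n |w|≤g)

All-subword : ∀ {P : Perm → Set} c zs → All P (letters zs) → All P (subword c zs)
All-subword c []             []         = []
All-subword c ((p , l) ∷ zs) (px ∷ pxs) with l ≟ c
... | yes _ = px ∷ All-subword c zs pxs
... | no  _ = All-subword c zs pxs

sum-map-length : ∀ (ws : List (List Perm)) → sum (map length ws) ≡ length (concat ws)
sum-map-length []       = refl
sum-map-length (w ∷ ws) = trans (cong (length w +_) (sum-map-length ws)) (sym (length-++ w))

sumSize-take : ∀ k ps → sumSize (take k ps) ≡ offset (map size ps) k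
sumSize-take zero    ps       = refl
sumSize-take (suc k) []       = refl
sumSize-take (suc k) (p ∷ ps) = cong (size p +_) (sumSize-take k ps)

emptyPerm : Perm
emptyPerm = perm 0 (λ ()) ((λ { {()} }) , (λ ()))

nthPerm : List Perm → ℕ → Perm
nthPerm []       _       = emptyPerm
nthPerm (p ∷ ps) zero    = p
nthPerm (p ∷ ps) (suc i) = nthPerm ps i

size-nthPerm : ∀ ps i → size (nthPerm ps i) ≡ at (map size ps) i
size-nthPerm []       i       = refl
size-nthPerm (p ∷ ps) zero    = refl
size-nthPerm (p ∷ ps) (suc i) = size-nthPerm ps i

lookup≡nthPerm : ∀ ps i (i<n : i < length ps) → lookup ps (fromℕ< i<n) ≡ nthPerm ps i
lookup≡nthPerm (p ∷ ps) zero    _         = refl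
lookup≡nthPerm (p ∷ ps) (suc i) (s≤s i<n) = lookup≡nthPerm ps i i<n

blockWords : ∀ {πs} → All Lyndon πs → List (List Perm)
blockWords []             = []
blockWords ((w , _) ∷ ls) = w ∷ blockWords ls

length-blockWords : ∀ {πs} (lyn : All Lyndon πs) → length (blockWords lyn) ≡ length πs
length-blockWords []       = refl
length-blockWords (_ ∷ ls) = cong suc (length-blockWords ls)

blockWords-SumOfℕ : ∀ {πs} (lyn : All Lyndon πs) → Pointwise SumOfℕ πs (blockWords lyn)
blockWords-SumOfℕ []                                   = []
blockWords-SumOfℕ {π ∷ _} ((w , (_ , π≡w) , _) ∷ ls) = IsSumOf⇒SumOfℕ π w π≡w ∷ blockWords-SumOfℕ ls

blockWords-indecomposable : ∀ {πs} (lyn : All Lyndon πs) → All Indecomposable (concat (blockWords lyn))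
blockWords-indecomposable []                          = []
blockWords-indecomposable ((_ , (w-ind , _) , _) ∷ ls) = All.++⁺ w-ind (blockWords-indecomposable ls)

blockWords-lyndon : ∀ {πs} (lyn : All Lyndon πs) → All IsLyndon (blockWords lyn)
blockWords-lyndon []                  = []
blockWords-lyndon ((_ , _ , ly) ∷ ls) = ly ∷ blockWords-lyndon ls

blockWords-nth : ∀ {πs} (lyn : All Lyndon πs) i → i < length πs → IsBlockWord (nthPerm πs i) (nth (blockWords lyn) i)
blockWords-nth ((_ , bw , _) ∷ _)  zero    _         = bw
blockWords-nth (_ ∷ ls)            (suc i) (s≤s i<n) = blockWords-nth ls i i<n

blockWords-descending : ∀ {πs} (lyn : All Lyndon πs) → Linked _>L_ πs → AllPairs (λ u v → v <W u) (blockWords lyn)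
blockWords-descending lyn desc = Linked⇒AllPairs (λ v<u w<v → <W-trans w<v v<u) (linked lyn desc)
  where
  linked : ∀ {πs} (lyn : All Lyndon πs) → Linked _>L_ πs → Linked (λ u v → v <W u) (blockWords lyn)
  linked []           _   = []
  linked (_ ∷ [])     _   = [-]
  linked {π ∷ π′ ∷ _} ((w₀ , bw₀ , _) ∷ l₁@(w₁ , bw₁ , _) ∷ ls) ((v , v′ , bw , bw′ , v′<v) ∷ desc) =
    <W-respʳ-≋ (IsBlockWord-unique π v w₀ bw bw₀) (<W-respˡ-≋ (IsBlockWord-unique π′ v′ w₁ bw′ bw₁) v′<v)
    ∷ linked (l₁ ∷ ls) desc

-- The occurrences of π₁, …, πₙ in their sum

module Lemma3p1 (πs : List Perm) (lyn : All Lyndon πs) (desc : Linked _>L_ πs)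
                (J : Fin (length πs) → Subset (sumSize πs)) (disjoint : PairwiseDisjoint J)
                (patterns : ∀ i → PatternIs (sumFun πs) (J i) (lookup πs i)) where

  n : ℕ
  n = length πs

  N : ℕ
  N = sumSize πs

  sizes : List ℕ
  sizes = map size πs

  σ : ℕ → ℕ
  σ = sumFunℕ πs

  πᵢ : ℕ → Perm
  πᵢ = nthPerm πs

  sᵢ : ℕ → ℕ
  sᵢ = at sizes

  InJ : ℕ → ℕ → Set
  InJ i x = Σ (i < n) λ i<n → Σ (x < N) λ x<N → fromℕ< x<N ∈ J (fromℕ< i<n)

  InJ-unique : ∀ {i i′ x} → InJ i x → InJ i′ x → i ≡ i′
  InJ-unique {i} {i′} (i<n , x<N , x∈Jᵢ) (i′<n , _ , x∈Jᵢ′) with i ≟ i′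
  ... | yes i≡i′ = i≡i′
  ... | no  i≢i′ = contradiction x∈Jᵢ′ (disjoint _ _ (i≢i′ ∘ fromℕ<-injective′) (fromℕ< x<N) x∈Jᵢ)
    where
    fromℕ<-injective′ : fromℕ< i<n ≡ fromℕ< i′<n → i ≡ i′
    fromℕ<-injective′ e = trans (sym (toℕ-fromℕ< i<n)) (trans (cong toℕ e) (toℕ-fromℕ< i′<n))

  size-lookup : ∀ {i} (i<n : i < n) → size (lookup πs (fromℕ< i<n)) ≡ sᵢ i
  size-lookup {i} i<n = trans (cong size (lookup≡nthPerm πs i i<n)) (size-nthPerm πs i)

  -- the occurrence of πᵢ on Jᵢ, on ℕ (0 out of range)
  emb : ℕ → ℕ → ℕ
  emb i a with i <? n
  ... | no  _   = 0
  ... | yes i<n with a <? size (lookup πs (fromℕ< i<n))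
  ...   | no  _   = 0
  ...   | yes a<s = toℕ (proj₁ (patterns (fromℕ< i<n)) (fromℕ< a<s))

  module _ {i : ℕ} (i<n : i < n) where
    private
      c : Fin n
      c = fromℕ< i<n
      k : Fin (size (lookup πs c)) → Fin N
      k = proj₁ (patterns c)
      k-increasing = proj₁ (proj₂ (patterns c))
      k-image = proj₁ (proj₂ (proj₂ (patterns c)))
      k-order = proj₂ (proj₂ (proj₂ (patterns c)))
      a<s⇒ : ∀ {a} → a < sᵢ i → a < size (lookup πs c)
      a<s⇒ = subst (_ <_) (sym (size-lookup i<n))

    emb-k : ∀ {a} (a<s : a < sᵢ i) → emb i a ≡ toℕ (k (fromℕ< (a<s⇒ a<s)))
    emb-k {a} a<s with i <? n
    ... | no  i≮n = contradiction i<n i≮n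
    ... | yes _ with a <? size (lookup πs c)
    ...   | no  a≮s = contradiction (a<s⇒ a<s) a≮s
    ...   | yes _   = refl

    emb-increasing : StrictlyIncreasing (emb i) (sᵢ i)
    emb-increasing a b a<b b<s = subst₂ _<_ (sym (emb-k a<s)) (sym (emb-k b<s))
      (k-increasing _ _ (subst₂ _<_ (sym (toℕ-fromℕ< (a<s⇒ a<s))) (sym (toℕ-fromℕ< (a<s⇒ b<s))) a<b))
      where a<s = <-trans a<b b<s

    emb<N : ∀ {a} → a < sᵢ i → emb i a < N
    emb<N a<s = subst (_< N) (sym (emb-k a<s)) (toℕ<n _)

    emb∈J : ∀ {a} → a < sᵢ i → InJ i (emb i a)
    emb∈J {a} a<s = i<n , emb<N a<s , subst (_∈ J c) (sym fromℕ<-emb) (Equivalence.from (k-image _) (_ , refl))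
      where
      fromℕ<-emb : fromℕ< (emb<N a<s) ≡ k (fromℕ< (a<s⇒ a<s))
      fromℕ<-emb = toℕ-injective (trans (toℕ-fromℕ< (emb<N a<s)) (emb-k a<s))

    emb-onto : ∀ {x} → InJ i x → ∃ λ a → a < sᵢ i × emb i a ≡ x
    emb-onto {x} (_ , x<N , x∈J) = toℕ j , j<s , (begin
      emb i (toℕ j)                         ≡⟨ emb-k j<s ⟩
      toℕ (k (fromℕ< _))                    ≡⟨ cong (toℕ ∘ k) (fromℕ<-toℕ j _) ⟩
      toℕ (k j)                             ≡⟨ cong toℕ kj≡x ⟩
      toℕ (fromℕ< x<N)                      ≡⟨ toℕ-fromℕ< x<N ⟩
      x                                     ∎)
      where
      open ≡-Reasoning
      preimage = Equivalence.to (k-image (fromℕ< x<N)) x∈J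
      j = proj₁ preimage
      kj≡x = proj₂ preimage
      j<s : toℕ j < sᵢ i
      j<s = subst (toℕ j <_) (size-lookup i<n) (toℕ<n j)

    emb-order : ∀ {a b} → a < sᵢ i → b < sᵢ i → (funℕ (πᵢ i) a < funℕ (πᵢ i) b) ⇔ (σ (emb i a) < σ (emb i b))
    emb-order {a} {b} a<s b<s = subst (λ π → (funℕ π a < funℕ π b) ⇔ (σ (emb i a) < σ (emb i b))) (lookup≡nthPerm πs i i<n)
      (mk⇔ (λ lt → subst₂ _<_ (σ-emb a<s) (σ-emb b<s)
                     (Equivalence.to order (subst₂ _<_ (funℕ-< πc (a<s⇒ a<s)) (funℕ-< πc (a<s⇒ b<s)) lt)))
           (λ lt → subst₂ _<_ (sym (funℕ-< πc (a<s⇒ a<s))) (sym (funℕ-< πc (a<s⇒ b<s)))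
                     (Equivalence.from order (subst₂ _<_ (sym (σ-emb a<s)) (sym (σ-emb b<s)) lt))))
      where
      πc = lookup πs c
      order = k-order (fromℕ< (a<s⇒ a<s)) (fromℕ< (a<s⇒ b<s))
      σ-emb : ∀ {d} (d<s : d < sᵢ i) → toℕ (sumFun πs (k (fromℕ< (a<s⇒ d<s)))) ≡ σ (emb i d)
      σ-emb d<s = trans (toℕ-sumFun πs _) (cong σ (sym (emb-k d<s)))

  summand : ℕ → ℕ
  summand = blockOf sizes

  posIn : ℕ → ℕ
  posIn y = y ∸ offset sizes (summand y)

  module _ {y} (y<N : y < N) where
    private
      y<Σ : y < sum sizes
      y<Σ = subst (y <_) (sumSize≡sum πs) y<N

    summand<n : summand y < n
    summand<n = subst (summand y <_) (length-map size πs) (blockOf<length sizes y<Σ)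

    offset+posIn : offset sizes (summand y) + posIn y ≡ y
    offset+posIn = m+[n∸m]≡n (offset-blockOf≤ sizes y)

    posIn<s : posIn y < sᵢ (summand y)
    posIn<s = ∸offset<at sizes y<Σ

  -- Φ sends each position of the summand πᵢ of the sum to its occurrence in Jᵢ.
  Φ : ℕ → ℕ
  Φ y = emb (summand y) (posIn y)

  Φ<N : ∀ {y} → y < N → Φ y < N
  Φ<N y<N = emb<N (summand<n y<N) (posIn<s y<N)

  Φ∈J : ∀ {y} → y < N → InJ (summand y) (Φ y)
  Φ∈J y<N = emb∈J (summand<n y<N) (posIn<s y<N)

  Φ-injective : BoundedInjective Φ N
  Φ-injective y y′ y<N y′<N Φy≡Φy′ = begin
    y                                           ≡⟨ offset+posIn y<N ⟨
    offset sizes (summand y) + posIn y          ≡⟨ cong₂ (λ u v → offset sizes u + v) same-summand same-pos ⟩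
    offset sizes (summand y′) + posIn y′        ≡⟨ offset+posIn y′<N ⟩
    y′                                          ∎
    where
    open ≡-Reasoning
    same-summand : summand y ≡ summand y′
    same-summand = InJ-unique (subst (InJ (summand y)) Φy≡Φy′ (Φ∈J y<N)) (Φ∈J y′<N)
    same-pos : posIn y ≡ posIn y′
    same-pos = StrictlyIncreasing-injective (emb-increasing (summand<n y<N)) _ _ (posIn<s y<N)
      (subst (λ u → posIn y′ < sᵢ u) (sym same-summand) (posIn<s y′<N))
      (trans Φy≡Φy′ (cong (λ u → emb u (posIn y′)) (sym same-summand)))

  -- By counting, the Jᵢ cover [0, N).
  Φ-onto : ∀ x → x < N → ∃ λ y → y < N × Φ y ≡ x
  Φ-onto = bounded-injection⇒surjective Φ (λ _ → Φ<N) Φ-injective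

  Φ⁻¹ : ℕ → ℕ
  Φ⁻¹ = choose Φ-onto

  Φ⁻¹<N : ∀ {x} → x < N → Φ⁻¹ x < N
  Φ⁻¹<N {x} x<N = proj₁ (choose-spec Φ-onto x x<N)

  Φ∘Φ⁻¹ : ∀ {x} → x < N → Φ (Φ⁻¹ x) ≡ x
  Φ∘Φ⁻¹ {x} x<N = proj₂ (choose-spec Φ-onto x x<N)

  class : ℕ → ℕ
  class x = summand (Φ⁻¹ x)

  class-InJ : ∀ {x} → x < N → InJ (class x) x
  class-InJ x<N = subst (InJ (class _)) (Φ∘Φ⁻¹ x<N) (Φ∈J (Φ⁻¹<N x<N))

  InJ⇒class : ∀ {i x} → x < N → InJ i x → i ≡ class x
  InJ⇒class x<N x∈Jᵢ = InJ-unique x∈Jᵢ (class-InJ x<N)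

  ws : List (List Perm)
  ws = blockWords lyn

  L : List Perm
  L = concat ws

  wordLengths : List ℕ
  wordLengths = map length ws

  letterSizes : List ℕ
  letterSizes = map size L

  ws-sizes : map sumSize ws ≡ sizes
  ws-sizes = SumOfℕ-sizes (blockWords-SumOfℕ lyn)

  length-ws : length ws ≡ n
  length-ws = length-blockWords lyn

  sumSize-L : sumSize L ≡ N
  sumSize-L = trans (sumSize-concat ws) (trans (cong sum ws-sizes) (sym (sumSize≡sum πs)))

  <N⇒<ΣL : ∀ {x} → x < N → x < sumSize L
  <N⇒<ΣL = subst (_ <_) (sym sumSize-L)

  sum-letterSizes : sum letterSizes ≡ N
  sum-letterSizes = trans (sym (sumSize≡sum L)) sumSize-L

  σ≗L : ∀ x → x < N → σ x ≡ sumFunℕ L x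
  σ≗L = sumFunℕ-concat πs ws (blockWords-SumOfℕ lyn)

  L-indecomposable : All Indecomposable L
  L-indecomposable = blockWords-indecomposable lyn

  sumSize-wᵢ : ∀ i → sumSize (nth ws i) ≡ sᵢ i
  sumSize-wᵢ i = trans (sym (at-map-sumSize ws i)) (cong (λ z → at z i) ws-sizes)

  πᵢ≗wᵢ : ∀ {i} → i < n → ∀ x → x < sᵢ i → funℕ (πᵢ i) x ≡ sumFunℕ (nth ws i) x
  πᵢ≗wᵢ {i} i<n x x<s = proj₂ (IsSumOf⇒SumOfℕ (πᵢ i) (nth ws i) (proj₂ (blockWords-nth lyn i i<n))) x
                               (subst (x <_) (sym (size-nthPerm πs i)) x<s)

  letterOf-L : ∀ {y} → y < N → letterOf L y ≡ offset wordLengths (summand y) + letterOf (nth ws (summand y)) (posIn y)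
  letterOf-L {y} y<N = begin
    letterOf L y                                                  ≡⟨ cong (letterOf L) (offset+posIn y<N) ⟨
    letterOf L (offset sizes (summand y) + posIn y)               ≡⟨ cong (λ z → letterOf L (offset z (summand y) + posIn y)) ws-sizes ⟨
    letterOf L (offset (map sumSize ws) (summand y) + posIn y)    ≡⟨ letterOf-concat ws (summand y) (posIn y)
                                                                       (subst (summand y <_) (sym length-ws) (summand<n y<N))
                                                                       (subst (posIn y <_) (sym (sumSize-wᵢ (summand y))) (posIn<s y<N)) ⟩
    offset wordLengths (summand y) + letterOf (nth ws (summand y)) (posIn y) ∎
    where open ≡-Reasoning

  summand-letterOf : ∀ {y} → y < N → blockOf wordLengths (letterOf L y) ≡ summand y
  summand-letterOf {y} y<N = trans (cong (blockOf wordLengths) (letterOf-L y<N))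
    (blockOf-offset+ wordLengths (summand y) _ (subst (summand y <_) (sym (trans (length-map length ws) length-ws)) (summand<n y<N))
       (subst (letterOf w (posIn y) <_) (sym (at-map-length ws (summand y)))
          (subst (letterOf w (posIn y) <_) (length-map size w)
             (blockOf<length (map size w) (subst (posIn y <_) (trans (sym (sumSize-wᵢ (summand y))) (sumSize≡sum w)) (posIn<s y<N))))))
    where w = nth ws (summand y)

  -- Otherwise the positions of πᵢ up to a and from a + 1 on would form a cut of πᵢ
  -- strictly inside a letter of its block word.
  Φ-letter-step : ∀ z → suc z < N → letterOf L z ≡ letterOf L (suc z) → letterOf L (Φ z) ≡ letterOf L (Φ (suc z))
  Φ-letter-step z 1+z<N same with letterOf L (Φ z) ≟ letterOf L (Φ (suc z))
  ... | yes e = e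
  ... | no ne = contradiction same-in-w (Cut⇒letter-boundary w (proj₁ (blockWords-nth lyn i i<n)) a 1+a<Σw cut-w)
    where
    z<N = <-trans (n<1+n z) 1+z<N
    i = summand z
    i<n = summand<n z<N
    a = posIn z
    w = nth ws i
    same-summand : summand (suc z) ≡ i
    same-summand = trans (sym (summand-letterOf 1+z<N)) (trans (cong (blockOf wordLengths) (sym same)) (summand-letterOf z<N))
    pos-suc : posIn (suc z) ≡ suc a
    pos-suc = trans (cong (λ u → suc z ∸ offset sizes u) same-summand) (+-∸-assoc 1 (offset-blockOf≤ sizes z))
    1+a<s : suc a < sᵢ i
    1+a<s = subst₂ (λ u v → u < sᵢ v) pos-suc same-summand (posIn<s 1+z<N)
    1+a<Σw : suc a < sumSize w
    1+a<Σw = subst (suc a <_) (sym (sumSize-wᵢ i)) 1+a<s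
    same-in-w : letterOf w a ≡ letterOf w (suc a)
    same-in-w = +-cancelˡ-≡ (offset wordLengths i) _ _ (begin
      offset wordLengths i + letterOf w a     ≡⟨ letterOf-L z<N ⟨
      letterOf L z                            ≡⟨ same ⟩
      letterOf L (suc z)                      ≡⟨ letterOf-L 1+z<N ⟩
      offset wordLengths (summand (suc z)) + letterOf (nth ws (summand (suc z))) (posIn (suc z))
                                              ≡⟨ cong₂ (λ u v → offset wordLengths u + letterOf (nth ws u) v) same-summand pos-suc ⟩
      offset wordLengths i + letterOf w (suc a) ∎)
      where open ≡-Reasoning
    emb-inc = emb-increasing i<n
    letters-apart : letterOf L (emb i a) < letterOf L (emb i (suc a))
    letters-apart = ≤∧≢⇒< (blockOf-mono-≤ letterSizes (<⇒≤ (emb-inc a (suc a) (n<1+n a) 1+a<s)))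
                          (λ e → ne (trans e (cong (letterOf L) (sym (cong₂ emb same-summand pos-suc)))))
    cut : Cut (funℕ (πᵢ i)) (sᵢ i) (suc a)
    cut b b′ b<1+a 1+a≤b′ b′<s =
      Equivalence.from (emb-order i<n b<s b′<s)
        (subst₂ _<_ (sym (σ≗L _ (emb<N i<n b<s))) (sym (σ≗L _ (emb<N i<n b′<s)))
          (letterOf-<⇒sumFunℕ-< L _ _ (<N⇒<ΣL (emb<N i<n b′<s)) (begin-strict
            letterOf L (emb i b)       ≤⟨ blockOf-mono-≤ letterSizes (StrictlyIncreasing-mono-≤ emb-inc (≤-pred b<1+a) a<s) ⟩
            letterOf L (emb i a)       <⟨ letters-apart ⟩
            letterOf L (emb i (suc a)) ≤⟨ blockOf-mono-≤ letterSizes (StrictlyIncreasing-mono-≤ emb-inc 1+a≤b′ b′<s) ⟩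
            letterOf L (emb i b′)      ∎)))
      where
      open ≤-Reasoning
      a<s = <-trans (n<1+n a) 1+a<s
      b<s = <-trans b<1+a 1+a<s
    cut-w : Cut (sumFunℕ w) (sumSize w) (suc a)
    cut-w = subst (λ S → Cut (sumFunℕ w) S (suc a)) (sym (sumSize-wᵢ i)) (Cut-cong (πᵢ≗wᵢ i<n) cut)

  Φ-letter : ∀ st d → st + d < N → letterOf L st ≡ letterOf L (st + d) → letterOf L (Φ (st + d)) ≡ letterOf L (Φ st)
  Φ-letter st zero    _       _    = cong (letterOf L ∘ Φ) (+-identityʳ st)
  Φ-letter st (suc d) st+d<N same = begin
    letterOf L (Φ (st + suc d))   ≡⟨ cong (letterOf L ∘ Φ) (+-suc st d) ⟩
    letterOf L (Φ (suc (st + d))) ≡⟨ Φ-letter-step (st + d) (subst (_< N) (+-suc st d) st+d<N) same-step ⟨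
    letterOf L (Φ (st + d))       ≡⟨ Φ-letter st d st+d′<N same′ ⟩
    letterOf L (Φ st)             ∎
    where
    open ≡-Reasoning
    st+d′<N : st + d < N
    st+d′<N = <-trans (+-monoʳ-< st (n<1+n d)) st+d<N
    same′ : letterOf L st ≡ letterOf L (st + d)
    same′ = ≤-antisym (blockOf-mono-≤ letterSizes (m≤m+n st d))
                      (subst (letterOf L (st + d) ≤_) (sym same) (blockOf-mono-≤ letterSizes (+-monoʳ-≤ st (n≤1+n d))))
    same-step : letterOf L (st + d) ≡ letterOf L (suc (st + d))
    same-step = trans (sym same′) (trans same (cong (letterOf L) (+-suc st d)))

  letterStart : ℕ → ℕ
  letterStart x = offset letterSizes (letterOf L x)

  letterStart≤ : ∀ x → letterStart x ≤ x
  letterStart≤ = offset-blockOf≤ letterSizes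

  letterOf-letterStart : ∀ {x} → x < N → letterOf L (letterStart x) ≡ letterOf L x
  letterOf-letterStart x<N = blockOf-offset letterSizes (subst (_ <_) (sym sum-letterSizes) x<N)

  Φ-letterStart : ∀ {y} → y < N → letterOf L (Φ y) ≡ letterOf L (Φ (letterStart y))
  Φ-letterStart {y} y<N = subst (λ u → letterOf L (Φ u) ≡ letterOf L (Φ st)) (m+[n∸m]≡n (letterStart≤ y))
    (Φ-letter st (y ∸ st) (subst (_< N) (sym (m+[n∸m]≡n (letterStart≤ y))) y<N)
                 (trans (letterOf-letterStart y<N) (cong (letterOf L) (sym (m+[n∸m]≡n (letterStart≤ y))))))
    where st = letterStart y

  at-letterSizes>0 : ∀ {g} → g < length L → 0 < at letterSizes g
  at-letterSizes>0 = positive L L-indecomposable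
    where
    positive : ∀ L′ → All Indecomposable L′ → ∀ {g} → g < length L′ → 0 < at (map size L′) g
    positive (p ∷ _)  (p-ind ∷ _) {zero}  _         = proj₁ p-ind
    positive (_ ∷ L′) (_ ∷ L′-ind) {suc g} (s≤s g<n) = positive L′ L′-ind g<n

  length-letterSizes : length letterSizes ≡ length L
  length-letterSizes = length-map size L

  letterOf<length : ∀ {x} → x < N → letterOf L x < length L
  letterOf<length {x} x<N = subst (letterOf L x <_) length-letterSizes (blockOf<length letterSizes (subst (x <_) (sym sum-letterSizes) x<N))

  letterOffset<N : ∀ {g} → g < length L → offset letterSizes g < N
  letterOffset<N {g} g<n = begin-strict
    offset letterSizes g                       ≡⟨ +-identityʳ _ ⟨
    offset letterSizes g + 0                   <⟨ +-monoʳ-< (offset letterSizes g) (at-letterSizes>0 g<n) ⟩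
    offset letterSizes g + at letterSizes g    ≡⟨ offset-suc letterSizes g g<n′ ⟨
    offset letterSizes (suc g)                 ≤⟨ offset-mono-≤ letterSizes g<n′ ⟩
    offset letterSizes (length letterSizes)    ≡⟨ offset-length letterSizes ⟩
    sum letterSizes                            ≡⟨ sum-letterSizes ⟩
    N                                          ∎
    where
    open ≤-Reasoning
    g<n′ = subst (g <_) (sym length-letterSizes) g<n

  letterOf-letterOffset : ∀ {g} → g < length L → letterOf L (offset letterSizes g) ≡ g
  letterOf-letterOffset {g} g<n = trans (cong (letterOf L) (sym (+-identityʳ _)))
    (blockOf-offset+ letterSizes g 0 (subst (g <_) (sym length-letterSizes) g<n) (at-letterSizes>0 g<n))

  -- Φ induces a map Λ on letters, which is onto and hence injective
  Λ : ℕ → ℕ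
  Λ g = letterOf L (Φ (offset letterSizes g))

  Λ-letterOf : ∀ {y} → y < N → Λ (letterOf L y) ≡ letterOf L (Φ y)
  Λ-letterOf y<N = sym (Φ-letterStart y<N)

  Λ-onto : ∀ j → j < length L → ∃ λ g → g < length L × Λ g ≡ j
  Λ-onto j j<n = letterOf L y , letterOf<length y<N , (begin
    Λ (letterOf L y)        ≡⟨ Λ-letterOf y<N ⟩
    letterOf L (Φ y)        ≡⟨ cong (letterOf L) (Φ∘Φ⁻¹ (letterOffset<N j<n)) ⟩
    letterOf L x            ≡⟨ letterOf-letterOffset j<n ⟩
    j                       ∎)
    where
    open ≡-Reasoning
    x = offset letterSizes j
    y = Φ⁻¹ x
    y<N = Φ⁻¹<N (letterOffset<N j<n)

  Λ-injective : BoundedInjective Λ (length L)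
  Λ-injective = bounded-surjection⇒injective Λ (λ g g<n → letterOf<length (Φ<N (letterOffset<N g<n))) Λ-onto

  class-letterStart : ∀ {x} → x < N → class x ≡ class (letterStart x)
  class-letterStart {x} x<N = begin
    summand y₁                              ≡⟨ summand-letterOf y₁<N ⟨
    blockOf wordLengths (letterOf L y₁)     ≡⟨ cong (blockOf wordLengths) same-letter ⟩
    blockOf wordLengths (letterOf L y₂)     ≡⟨ summand-letterOf y₂<N ⟩
    summand y₂                              ∎
    where
    open ≡-Reasoning
    st<N = ≤-<-trans (letterStart≤ x) x<N
    y₁ = Φ⁻¹ x
    y₁<N = Φ⁻¹<N x<N
    y₂ = Φ⁻¹ (letterStart x)
    y₂<N = Φ⁻¹<N st<N
    same-letter : letterOf L y₁ ≡ letterOf L y₂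
    same-letter = Λ-injective _ _ (letterOf<length y₁<N) (letterOf<length y₂<N) (begin
      Λ (letterOf L y₁)               ≡⟨ Λ-letterOf y₁<N ⟩
      letterOf L (Φ y₁)               ≡⟨ cong (letterOf L) (Φ∘Φ⁻¹ x<N) ⟩
      letterOf L x                    ≡⟨ letterOf-letterStart x<N ⟨
      letterOf L (letterStart x)      ≡⟨ cong (letterOf L) (Φ∘Φ⁻¹ st<N) ⟨
      letterOf L (Φ y₂)               ≡⟨ Λ-letterOf y₂<N ⟨
      Λ (letterOf L y₂)               ∎)

  zs : Labelled
  zs = labelByStart class L 0

  letters-zs : letters zs ≡ L
  letters-zs = letters-labelByStart class L 0

  sumSize-zs : sumSize (letters zs) ≡ N
  sumSize-zs = trans (cong sumSize letters-zs) sumSize-L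

  labelAt-zs : ∀ {x} → x < N → labelAt zs x ≡ class x
  labelAt-zs {x} x<N = trans (labelAt-labelByStart class L 0 x (<N⇒<ΣL x<N)) (sym (class-letterStart x<N))

  module _ {i} (i<n : i < n) where
    private
      Sᵢ : ℕ
      Sᵢ = sumSize (subword i zs)

      emb⊆embed : ∀ a → a < sᵢ i → ∃ λ b → b < Sᵢ × embed i zs b ≡ emb i a
      emb⊆embed a a<s = embed-onto i zs _ (subst (emb i a <_) (sym sumSize-zs) (emb<N i<n a<s))
        (trans (labelAt-zs (emb<N i<n a<s)) (sym (InJ⇒class (emb<N i<n a<s) (emb∈J i<n a<s))))

      embed⊆emb : ∀ b → b < Sᵢ → ∃ λ a → a < sᵢ i × emb i a ≡ embed i zs b
      embed⊆emb b b<S = emb-onto i<n (subst (λ u → InJ u x) class≡i (class-InJ x<N))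
        where
        x = embed i zs b
        x<N : x < N
        x<N = subst (x <_) sumSize-zs (embed<sumSize i zs b b<S)
        class≡i : class x ≡ i
        class≡i = trans (sym (labelAt-zs x<N)) (labelAt-embed i zs b b<S)

      enumerations = increasing-enumerations-agree (emb-increasing i<n) (embed-increasing i zs) emb⊆embed embed⊆emb

      sᵢ≡Sᵢ : sᵢ i ≡ Sᵢ
      sᵢ≡Sᵢ = proj₁ enumerations

      <sᵢ⇒<Sᵢ : ∀ {a} → a < sᵢ i → a < Sᵢ
      <sᵢ⇒<Sᵢ {a} = subst (a <_) sᵢ≡Sᵢ

      σ-emb : ∀ {a} → a < sᵢ i → σ (emb i a) ≡ sumFunℕ (letters zs) (embed i zs a)
      σ-emb a<s = trans (σ≗L _ (emb<N i<n a<s)) (cong₂ sumFunℕ (sym letters-zs) (proj₂ enumerations _ a<s))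

      subword-order : ∀ a b → a < sᵢ i → b < sᵢ i →
                      (funℕ (πᵢ i) a < funℕ (πᵢ i) b) ⇔ (sumFunℕ (subword i zs) a < sumFunℕ (subword i zs) b)
      subword-order a b a<s b<s = mk⇔
        (λ lt → Equivalence.to (embed-order i zs a b (<sᵢ⇒<Sᵢ a<s) (<sᵢ⇒<Sᵢ b<s))
                  (subst₂ _<_ (σ-emb a<s) (σ-emb b<s) (Equivalence.to (emb-order i<n a<s b<s) lt)))
        (λ lt → Equivalence.from (emb-order i<n a<s b<s)
                  (subst₂ _<_ (sym (σ-emb a<s)) (sym (σ-emb b<s))
                     (Equivalence.from (embed-order i zs a b (<sᵢ⇒<Sᵢ a<s) (<sᵢ⇒<Sᵢ b<s)) lt)))

      size-πᵢ : size (πᵢ i) ≡ sᵢ i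
      size-πᵢ = size-nthPerm πs i

      πᵢ≗subword : ∀ a → a < sᵢ i → funℕ (πᵢ i) a ≡ sumFunℕ (subword i zs) a
      πᵢ≗subword = order-isomorphic⇒≡
        (λ x x<s → subst (funℕ (πᵢ i) x <_) size-πᵢ (funℕ<size (πᵢ i) (subst (x <_) (sym size-πᵢ) x<s)))
        (λ y y<s → let x , x<s , πx≡y = funℕ-surjective (πᵢ i) (subst (y <_) (sym size-πᵢ) y<s)
                   in x , subst (x <_) size-πᵢ x<s , πx≡y)
        (λ x x<s → subst (sumFunℕ (subword i zs) x <_) (sym sᵢ≡Sᵢ) (sumFunℕ<sumSize (subword i zs) (<sᵢ⇒<Sᵢ x<s)))
        (λ a b a<s b<s → Equivalence.to (subword-order a b a<s b<s))
        (λ a b a<s b<s → Equivalence.from (subword-order a b a<s b<s))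

    subword≋wᵢ : subword i zs ≋ nth ws i
    subword≋wᵢ = ≋-sym (indecomposable-sum-unique (nth ws i) (subword i zs)
      (proj₁ (blockWords-nth lyn i i<n))
      (All-subword i zs (subst (All Indecomposable) (sym letters-zs) L-indecomposable))
      (trans (sumSize-wᵢ i) sᵢ≡Sᵢ)
      (λ x x<Σ → let x<s = subst (x <_) (sumSize-wᵢ i) x<Σ in trans (sym (πᵢ≗wᵢ i<n x x<s)) (πᵢ≗subword x x<s)))

  labels-zs : labels zs ≡ canonicalLabels 0 ws
  labels-zs = labels-canonical ws 0 zs (blockWords-lyndon lyn) (blockWords-descending lyn desc) (≡⇒≋ letters-zs) bounds
    (λ i i<|ws| → subword≋wᵢ (subst (i <_) length-ws i<|ws|))
    where
    bounds : ∀ c → Occurs c zs → 0 ≤ c × c < length ws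
    bounds c c∈ = let d , d<Σ , c≡ = Occurs-labelByStart class L 0 L-indecomposable c c∈
                  in z≤n , subst (c <_) (sym length-ws) (subst (_< n) (sym c≡) (proj₁ (class-InJ (subst (d <_) sumSize-L d<Σ))))

  class≡summand : ∀ {x} → x < N → class x ≡ summand x
  class≡summand {x} x<N = begin
    class x                                                ≡⟨ labelAt-zs x<N ⟨
    labelAt zs x                                           ≡⟨ labelAt≡at-labels zs x (subst (x <_) (sym sumSize-zs) x<N) ⟩
    at (labels zs) (letterOf (letters zs) x)               ≡⟨ cong₂ at labels-zs (cong (λ u → letterOf u x) letters-zs) ⟩
    at (canonicalLabels 0 ws) (letterOf L x)               ≡⟨ at-canonicalLabels ws 0 (letterOf L x) letter<Σ ⟩
    blockOf wordLengths (letterOf L x)                     ≡⟨ summand-letterOf x<N ⟩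
    summand x                                              ∎
    where
    open ≡-Reasoning
    letter<Σ : letterOf L x < sum wordLengths
    letter<Σ = subst (letterOf L x <_) (sym (sum-map-length ws)) (letterOf<length x<N)

  InJ⇔summand : ∀ {i x} → i < n → x < N → InJ i x ⇔ (offset sizes i ≤ x × x < offset sizes i + sᵢ i)
  InJ⇔summand {i} {x} i<n x<N = mk⇔
    (λ x∈Jᵢ → subst (λ u → offset sizes u ≤ x × x < offset sizes u + sᵢ u)
                    (sym (trans (InJ⇒class x<N x∈Jᵢ) (class≡summand x<N)))
                    (offset-blockOf≤ sizes x , <offset-blockOf+at sizes (subst (x <_) (sumSize≡sum πs) x<N)))
    (λ (≤x , x<) → subst (λ u → InJ u x) (trans (class≡summand x<N) (blockOf-unique sizes i i<|sizes| ≤x x<)) (class-InJ x<N))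
    where
    i<|sizes| : i < length sizes
    i<|sizes| = subst (i <_) (sym (length-map size πs)) i<n

  ∈J⇔summand : ∀ (c : Fin n) (x : Fin N) → (x ∈ J c) ⇔
    (sumSize (take (toℕ c) πs) ≤ toℕ x × toℕ x < sumSize (take (toℕ c) πs) + size (lookup πs c))
  ∈J⇔summand c x = mk⇔
    (λ x∈J → to-offsets (Equivalence.to (InJ⇔summand (toℕ<n c) (toℕ<n x))
                           (toℕ<n c , toℕ<n x , subst₂ (λ a b → a ∈ J b) (sym x′≡x) (sym c′≡c) x∈J)))
    (λ bounds → let (_ , _ , x∈J) = Equivalence.from (InJ⇔summand (toℕ<n c) (toℕ<n x)) (from-offsets bounds)
                in subst₂ (λ a b → a ∈ J b) x′≡x c′≡c x∈J)
    where
    c′≡c = fromℕ<-toℕ c (toℕ<n c)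
    x′≡x = fromℕ<-toℕ x (toℕ<n x)
    offset≡ : offset sizes (toℕ c) ≡ sumSize (take (toℕ c) πs)
    offset≡ = sym (sumSize-take (toℕ c) πs)
    size≡ : sᵢ (toℕ c) ≡ size (lookup πs c)
    size≡ = trans (sym (size-lookup (toℕ<n c))) (cong (size ∘ lookup πs) c′≡c)
    to-offsets : offset sizes (toℕ c) ≤ toℕ x × toℕ x < offset sizes (toℕ c) + sᵢ (toℕ c) →
                 sumSize (take (toℕ c) πs) ≤ toℕ x × toℕ x < sumSize (take (toℕ c) πs) + size (lookup πs c)
    to-offsets (≤x , x<) = subst (_≤ toℕ x) offset≡ ≤x , subst₂ (λ u v → toℕ x < u + v) offset≡ size≡ x<
    from-offsets : sumSize (take (toℕ c) πs) ≤ toℕ x × toℕ x < sumSize (take (toℕ c) πs) + size (lookup πs c) →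
                   offset sizes (toℕ c) ≤ toℕ x × toℕ x < offset sizes (toℕ c) + sᵢ (toℕ c)
    from-offsets (≤x , x<) = subst (_≤ toℕ x) (sym offset≡) ≤x , subst₂ (λ u v → toℕ x < u + v) (sym offset≡) (sym size≡) x<

  J-interval : ∀ c → IsInterval (J c)
  J-interval c x y z x∈J z∈J x≤y y≤z =
    Equivalence.from (∈J⇔summand c y) (≤-trans (proj₁ (Equivalence.to (∈J⇔summand c x) x∈J)) x≤y ,
                                       ≤-<-trans y≤z (proj₂ (Equivalence.to (∈J⇔summand c z) z∈J)))

lemma3p1 : (πs : List Perm) → All Lyndon πs → Linked _>L_ πs
    → (J : Fin (length πs) → Subset (sumSize πs))
    → PairwiseDisjoint J
    → (∀ i → PatternIs (sumFun πs) (J i) (lookup πs i))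
    → ∀ i → IsInterval (J i)
    × (∀ (x : Fin (sumSize πs)) → (x ∈ J i)
    ⇔ (sumSize (take (toℕ i) πs) ≤ toℕ x × toℕ x < sumSize (take (toℕ i) πs) + size (lookup πs i)))
lemma3p1 πs lyn desc J disjoint patterns i =
  Lemma3p1.J-interval πs lyn desc J disjoint patterns i , Lemma3p1.∈J⇔summand πs lyn desc J disjoint patterns i
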